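{- Let $F\in\mathcal{F}_n$. For a $213$-avoiding full rook placement $R$ on $F$, let $F_R$ be the smallest Ferrers board containing all squares of $R$, and set $\delta_{213}(R)=(D_{F_R},D_F)$. Then $\delta_{213}$ is a bijection from the set $\mathcal{R}_F(213)$ of $213$-avoiding full rook placements on $F$ onto $\mathcal{D}^2_F$. Consequently there is a bijection $\mathcal{M}_F(213)\to\mathcal{D}^2_F$.
   Context: A Dyck path of semilength $n$ is a lattice path from $(0,n)$ to $(n,0)$ with unit east and south steps never going strictly below $y=n-x$; $\mathcal{D}_n$ is their set. $\mathcal{F}_n$ is the set of Ferrers boards (left-justified arrays of unit squares bounded by the coordinate axes and a path, rows weakly shorter going up) whose border $D_F$ is such a Dyck path. $\mathcal{D}^2_F$ is the set of pairs $(D_0,D_F)$, $D_0\in\mathcal{D}_n$, with $D_0$ never strictly above $D_F$. A full rook placement $R$ on $F$ has exactly one square in each row and column of $F$; $\Gamma(V)$ for a border vertex $V=(a,b)$ is the set of unit squares in $[0,a]\times[0,b]$; a set of squares with at most one per row and column determines a permutation by standardizing. $R$ avoids $\tau$ if for every border vertex $V$ the permutation determined by $R\cap\Gamma(V)$ avoids $\tau$. Matchings: $\mathcal{M}_F(\tau)$ is the set of perfect matchings $M$ of $[2n]$ whose shape is $F$ (border read from $1$ to $2n$: east step for each opener, south for each closer) avoiding $\tau\in S_k$, i.e. with no $i_1<\dots<i_{2k}$ such that all pairs $(i_a,i_{2k+1-\tau(a)})$ lie in $M$. -}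

module Defs where

open import Data.Nat using (ℕ; zero; suc; _+_; _∸_; _<_; _≤_; _⊔_)
open import Data.Fin as Fin using (Fin; toℕ; _↑ˡ_; _↑ʳ_; opposite)
open import Data.List as List using (List; []; _∷_; _++_; replicate; reverse; map; length)
open import Data.Vec as Vec using (Vec; lookup; toList)
open import Data.Product using (Σ; Σ-syntax; ∃; ∃-syntax; _×_; _,_; proj₁; proj₂)
open import Relation.Nullary using (¬_)
open import Relation.Binary.PropositionalEquality using (_≡_; _≢_; setoid)
open import Relation.Binary.Bundles using (Setoid)
import Relation.Binary.Construct.On as On
open import Function.Base using (_on_)
open import Function.Bundles using (_⇔_; Bijection)
open import Function.Definitions using (Bijective)
open import Data.List.Membership.Propositional using (_∈_)

data Step : Set where
  E S : Step

-- Starting at (0,n): after i east and j south steps we are at (i, n-j).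
-- "Never strictly below y = n - x" means j ≤ i along every prefix.
-- DyckFrom h p : the remaining path p, started with current excess
-- h = i - j of east over south steps, keeps the excess ≥ 0 and ends at 0.
data DyckFrom : ℕ → List Step → Set where
  done  : DyckFrom 0 []
  east  : ∀ {h p} → DyckFrom (suc h) p → DyckFrom h (E ∷ p)
  south : ∀ {h p} → DyckFrom h p → DyckFrom (suc h) (S ∷ p)

#E : List Step → ℕ
#E []       = 0
#E (E ∷ p)  = suc (#E p)
#E (S ∷ p)  = #E p

IsDyck : ℕ → List Step → Set
IsDyck n p = DyckFrom 0 p × #E p ≡ n

#Eprefix : ℕ → List Step → ℕ
#Eprefix zero    p        = 0
#Eprefix (suc k) []       = 0
#Eprefix (suc k) (E ∷ p)  = suc (#Eprefix k p)
#Eprefix (suc k) (S ∷ p)  = #Eprefix k p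

-- D₀ never goes strictly above D₁ (both from (0,n)): after k steps both
-- lie on the line y - x = n - k, and D₀'s point is not above D₁'s,
-- i.e. D₀ has made at most as many east steps as D₁.
NotAbove : List Step → List Step → Set
NotAbove D₀ D₁ = ∀ k → #Eprefix k D₀ ≤ #Eprefix k D₁

vertsFrom : ℕ → ℕ → List Step → List (ℕ × ℕ)
vertsFrom x y []       = (x , y) ∷ []
vertsFrom x y (E ∷ p)  = (x , y) ∷ vertsFrom (suc x) y p
vertsFrom x y (S ∷ p)  = (x , y) ∷ vertsFrom x (y ∸ 1) p

-- A board with n rows, given by its row lengths, row 0 at the bottom;
-- square (c , r) (column c, row r, i.e. [c,c+1]×[r,r+1]) belongs to the
-- board iff c < length of row r.
Board : ℕ → Set
Board n = Vec ℕ n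

IsFerrers : ∀ {n} → Board n → Set
IsFerrers {n} λs = ∀ (i j : Fin n) → toℕ i ≤ toℕ j → lookup λs j ≤ lookup λs i

-- border from the top-left corner: rows listed from top to bottom
borderTB : ℕ → List ℕ → List Step
borderTB prev []       = []
borderTB prev (l ∷ ls) = replicate (l ∸ prev) E ++ (S ∷ borderTB l ls)

borderL : List ℕ → List Step
borderL rows = borderTB 0 (reverse rows)

border : ∀ {n} → Board n → List Step
border λs = borderL (toList λs)

InFerrersDyck : (n : ℕ) → Board n → Set
InFerrersDyck n F = IsFerrers F × IsDyck n (border F)

BorderVertex : ∀ {n} → Board n → ℕ × ℕ → Set
BorderVertex {n} F V = V ∈ vertsFrom 0 n (border F)

InΓ : ℕ × ℕ → ℕ × ℕ → Set
InΓ (a , b) (c , r) = suc c ≤ a × suc r ≤ b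

-- A placement with exactly one rook per row is given by the column
-- σ[r] of the rook in row r; its squares are (σ[r] , r).
Placement : ℕ → Set
Placement n = Vec (Fin n) n

rook : ∀ {n} → Placement n → Fin n → ℕ × ℕ
rook σ r = (toℕ (lookup σ r) , toℕ r)

IsFullRookPlacement : ∀ {n} → Board n → Placement n → Set
IsFullRookPlacement {n} F σ =
  (∀ (r : Fin n) → toℕ (lookup σ r) < lookup F r)
  × (∀ (r r′ : Fin n) → lookup σ r ≡ lookup σ r′ → r ≡ r′)
  × (∀ (c : Fin n) → ∃[ r ] lookup σ r ≡ c)

-- The permutation obtained by standardizing the rooks of σ lying in Γ(V)
-- contains τ ∈ S_k: there are k of those rooks, in rows ρ(0..k-1), with
-- strictly increasing columns, whose rows are ordered like τ.
ContainsIn : ∀ {n k} → Vec (Fin k) k → Placement n → ℕ × ℕ → Set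
ContainsIn {n} {k} τ σ V =
  Σ[ ρ ∈ (Fin k → Fin n) ]
    (∀ a → InΓ V (rook σ (ρ a)))
    × (∀ (a b : Fin k) → toℕ a < toℕ b → toℕ (lookup σ (ρ a)) < toℕ (lookup σ (ρ b)))
    × (∀ (a b : Fin k) → (toℕ (ρ a) < toℕ (ρ b)) ⇔ (toℕ (lookup τ a) < toℕ (lookup τ b)))

AvoidsR : ∀ {n k} → Vec (Fin k) k → Board n → Placement n → Set
AvoidsR τ F σ = ∀ V → BorderVertex F V → ¬ ContainsIn τ σ V

RF : ∀ {n k} → Vec (Fin k) k → Board n → Set
RF {n} τ F = Σ[ σ ∈ Placement n ] IsFullRookPlacement F σ × AvoidsR τ F σ

-- the pattern 213 (0-based: 1 0 2)
τ213 : Vec (Fin 3) 3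
τ213 = Vec._∷_ (Fin.suc Fin.zero) (Vec._∷_ Fin.zero (Vec._∷_ (Fin.suc (Fin.suc Fin.zero)) Vec.[]))

sufmax : List ℕ → List ℕ
sufmax []       = []
sufmax (x ∷ xs) = go (sufmax xs)
  where
  go : List ℕ → List ℕ
  go []          = x ∷ []
  go (m ∷ ms)    = (x ⊔ m) ∷ m ∷ ms

-- F_R: smallest Ferrers board containing all squares (σ[r] , r) of R;
-- its row r has length max { σ[r′] + 1 | r′ ≥ r } (rows listed bottom to top)
FR-rows : ∀ {n} → Placement n → List ℕ
FR-rows σ = sufmax (map (λ c → suc (toℕ c)) (toList σ))

DFR : ∀ {n} → Placement n → List Step
DFR σ = borderL (FR-rows σ)

InD2 : ∀ {n} → Board n → List Step × List Step → Set
InD2 {n} F (D₀ , D₁) = IsDyck n D₀ × D₁ ≡ border F × NotAbove D₀ D₁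

D2 : ∀ {n} → Board n → Set
D2 F = Σ (List Step × List Step) (InD2 F)

D2-setoid : ∀ {n} → Board n → Setoid _ _
D2-setoid F = On.setoid (setoid (List Step × List Step)) (proj₁ {B = InD2 F})

-- Perfect matchings of [2n] = {0,…,2n-1}, given by the partner function

Matching : ℕ → Set
Matching n = Vec (Fin (n + n)) (n + n)

IsPerfectMatching : ∀ {n} → Matching n → Set
IsPerfectMatching {n} M =
  (∀ i → lookup M (lookup M i) ≡ i) × (∀ i → lookup M i ≢ i)

stepOf : ∀ {m} → Fin m → Fin m → Step
stepOf i j with toℕ i Data.Nat.<? toℕ j
  where open import Data.Nat using (_<?_)
... | Relation.Nullary.yes _ = E
... | Relation.Nullary.no  _ = S

shape : ∀ {n} → Matching n → List Step
shape {n} M = toList (Vec.tabulate (λ i → stepOf i (lookup M i)))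

-- M contains τ ∈ S_k: positions f(0) < … < f(2k-1) with every
-- (f(a) , f(2k-1-τ(a))) a pair of M (0-based form of (i_a , i_{2k+1-τ(a)}))
ContainsM : ∀ {n k} → Vec (Fin k) k → Matching n → Set
ContainsM {n} {k} τ M =
  Σ[ f ∈ (Fin (k + k) → Fin (n + n)) ]
    (∀ (a b : Fin (k + k)) → toℕ a < toℕ b → toℕ (f a) < toℕ (f b))
    × (∀ (a : Fin k) → lookup M (f (a ↑ˡ k)) ≡ f (k ↑ʳ opposite (lookup τ a)))

InMF : ∀ {n k} → Vec (Fin k) k → Board n → Matching n → Set
InMF {n} τ F M = IsPerfectMatching {n} M × shape {n} M ≡ border F × ¬ ContainsM {n} τ M

MF : ∀ {n k} → Vec (Fin k) k → Board n → Set
MF {n} τ F = Σ (Matching n) (InMF τ F)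

MF-setoid : ∀ {n k} → Vec (Fin k) k → Board n → Setoid _ _
MF-setoid {n} τ F = On.setoid (setoid (Matching n)) (proj₁ {B = InMF τ F})

-- Read the columns of the rooks of a full rook placement R from the top row down as a list T. The rows of F_R
-- are the running maxima of T + 1, and R avoids 213 exactly when T avoids 312: the border vertex at the right
-- end of the top row of an occurrence sees all three of its rooks. A 312-avoiding permutation is determined by
-- its running maxima, since an entry that does not raise the maximum must be the largest value not used yet.
-- Conversely this greedy rule turns every Dyck path below D_F into such a T whose running maxima have that
-- path as border; the Dyck condition is the pigeonhole bound length ≤ maximum for the distinct prefixes of T.
-- For a matching, the columns of the openers matched with the successive closers form the same kind of list T,
-- and an occurrence of 213 in the matching is an occurrence of 312 in T.

module Submission where

open import Defs
open import Data.Nat using (ℕ)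
open import Data.Product using (Σ-syntax; _×_; _,_; proj₁)
open import Relation.Binary.PropositionalEquality using (_≡_)
open import Function.Base using (_on_; _∋_)
open import Function.Bundles using (Bijection)
open import Function.Definitions using (Bijective)

module Lists where

  open import Data.Nat
  open import Data.Nat.Properties
  open import Data.List using (List; []; _∷_; _++_; [_]; length; reverse; map; downFrom; applyUpTo)
  open import Data.List.Relation.Binary.Pointwise using (Pointwise; []; _∷_)
  open import Function.Base using (_∘_)
  open import Data.List.Properties using (length-++; length-downFrom; length-reverse; length-applyUpTo; ++-assoc; reverse-++; unfold-reverse)
  open import Data.List.Membership.Propositional using (_∈_; _∉_)
  open import Data.List.Membership.DecPropositional _≟_ using (_∈?_)
  open import Data.List.Membership.Propositional.Properties
    using (∈-++⁺ˡ; ∈-++⁺ʳ; ∈-++⁻; ∈-∃++; ∈-downFrom⁺; ∈-downFrom⁻; ∈-applyUpTo⁻)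
  open import Data.List.Relation.Binary.Subset.Propositional using (_⊆_)
  open import Data.List.Relation.Unary.Any using (here; there)
  import Data.List.Relation.Unary.Any.Properties as Any
  open import Data.Product using (∃; _×_; _,_)
  open import Data.Sum using (_⊎_; inj₁; inj₂)
  open import Data.Empty using (⊥-elim)
  open import Data.Unit using (⊤; tt)
  open import Relation.Nullary using (yes; no)
  open import Relation.Binary.PropositionalEquality hiding ([_])

  private
    variable
      A : Set
      x y : A
      xs ys : List A

  Distinct : List A → Set
  Distinct []       = ⊤
  Distinct (x ∷ xs) = x ∉ xs × Distinct xs

  distinct-++⁻ˡ : ∀ xs → Distinct (xs ++ ys) → Distinct xs
  distinct-++⁻ˡ []       _         = tt
  distinct-++⁻ˡ (x ∷ xs) (x∉ , ds) = (λ p → x∉ (∈-++⁺ˡ p)) , distinct-++⁻ˡ xs ds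

  distinct-++⇒disjoint : ∀ xs → Distinct (xs ++ ys) → x ∈ xs → x ∉ ys
  distinct-++⇒disjoint (x ∷ xs) (x∉ , _)  (here refl) q = x∉ (∈-++⁺ʳ xs q)
  distinct-++⇒disjoint (x ∷ xs) (_ , ds)  (there p)   q = distinct-++⇒disjoint xs ds p q

  distinct-middle : ∀ xs → Distinct (xs ++ y ∷ ys) → y ∉ xs
  distinct-middle xs ds p = distinct-++⇒disjoint xs ds p (here refl)

  distinct-∷ʳ : ∀ xs → Distinct xs → x ∉ xs → Distinct (xs ++ [ x ])
  distinct-∷ʳ []       _         _  = (λ ()) , tt
  distinct-∷ʳ (y ∷ xs) (y∉ , ds) x∉ = y∉xs∷ʳx , distinct-∷ʳ xs ds (λ p → x∉ (there p))
    where
    y∉xs∷ʳx : y ∉ xs ++ [ _ ]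
    y∉xs∷ʳx p with ∈-++⁻ xs p
    ... | inj₁ q           = y∉ q
    ... | inj₂ (here refl) = x∉ (here refl)

  distinct-reverse : (xs : List A) → Distinct xs → Distinct (reverse xs)
  distinct-reverse []       _         = tt
  distinct-reverse (x ∷ xs) (x∉ , ds) =
    subst Distinct (sym (unfold-reverse x xs))
      (distinct-∷ʳ (reverse xs) (distinct-reverse xs ds) (λ p → x∉ (Any.reverse⁻ p)))

  distinct-downFrom : ∀ n → Distinct (downFrom n)
  distinct-downFrom zero    = tt
  distinct-downFrom (suc n) = (λ p → <-irrefl refl (∈-downFrom⁻ p)) , distinct-downFrom n

  distinct-⊆⇒length≤ : Distinct xs → xs ⊆ ys → length xs ≤ length ys
  distinct-⊆⇒length≤ {xs = []}     _         _   = z≤n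
  distinct-⊆⇒length≤ {xs = x ∷ xs} {ys} (x∉ , ds) xs⊆ys with ∈-∃++ (xs⊆ys (here refl))
  ... | us , vs , refl = begin
    suc (length xs)               ≤⟨ s≤s (distinct-⊆⇒length≤ ds xs⊆us++vs) ⟩
    suc (length (us ++ vs))       ≡⟨ cong suc (length-++ us) ⟩
    suc (length us + length vs)   ≡⟨ +-suc (length us) (length vs) ⟨
    length us + length (x ∷ vs)   ≡⟨ length-++ us ⟨
    length (us ++ x ∷ vs)         ∎
    where
    open ≤-Reasoning
    xs⊆us++vs : xs ⊆ us ++ vs
    xs⊆us++vs {z} z∈xs with ∈-++⁻ us (xs⊆ys (there z∈xs))
    ... | inj₁ p           = ∈-++⁺ˡ p
    ... | inj₂ (here refl) = ⊥-elim (x∉ z∈xs)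
    ... | inj₂ (there p)   = ∈-++⁺ʳ us p

  distinct-bounded⇒length≤ : ∀ {n} {xs : List ℕ} → Distinct xs → (∀ {x} → x ∈ xs → x < n) → length xs ≤ n
  distinct-bounded⇒length≤ {n} ds bnd =
    subst (_ ≤_) (length-downFrom n) (distinct-⊆⇒length≤ ds (λ p → ∈-downFrom⁺ (bnd p)))

  ⊇below⇒≤length : ∀ {n} {xs : List ℕ} → (∀ {k} → k < n → k ∈ xs) → n ≤ length xs
  ⊇below⇒≤length {n} below =
    subst (_≤ _) (length-downFrom n) (distinct-⊆⇒length≤ (distinct-downFrom n) (λ p → below (∈-downFrom⁻ p)))

  distinct-bounded-complete : ∀ {n} {xs : List ℕ} → Distinct xs → (∀ {x} → x ∈ xs → x < n) →
                              length xs ≡ n → ∀ {v} → v < n → v ∈ xs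
  distinct-bounded-complete {n} {xs} ds bnd refl {v} v<n with v ∈? xs
  ... | yes v∈ = v∈
  ... | no  v∉ = ⊥-elim (<-irrefl refl (distinct-bounded⇒length≤ {xs = v ∷ xs} (v∉ , ds) bnd′))
    where
    bnd′ : ∀ {x} → x ∈ v ∷ xs → x < length xs
    bnd′ (here refl) = v<n
    bnd′ (there p)   = bnd p

  maxSuc : List ℕ → ℕ
  maxSuc []       = 0
  maxSuc (x ∷ xs) = suc x ⊔ maxSuc xs

  ∈⇒<maxSuc : ∀ {x xs} → x ∈ xs → x < maxSuc xs
  ∈⇒<maxSuc {x} {y ∷ xs} (here refl) = m≤m⊔n (suc x) (maxSuc xs)
  ∈⇒<maxSuc {x} {y ∷ xs} (there p)   = ≤-trans (∈⇒<maxSuc p) (m≤n⊔m (suc y) (maxSuc xs))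

  maxSuc≤ : ∀ {n} xs → (∀ {x} → x ∈ xs → x < n) → maxSuc xs ≤ n
  maxSuc≤ []       _   = z≤n
  maxSuc≤ (x ∷ xs) bnd = ⊔-lub (bnd (here refl)) (maxSuc≤ xs (λ p → bnd (there p)))

  maxSuc-attained : ∀ xs → maxSuc xs ≡ 0 ⊎ ∃ λ x → x ∈ xs × maxSuc xs ≡ suc x
  maxSuc-attained []       = inj₁ refl
  maxSuc-attained (x ∷ xs) with ⊔-sel (suc x) (maxSuc xs) | maxSuc-attained xs
  ... | inj₁ e | _                  = inj₂ (x , here refl , e)
  ... | inj₂ e | inj₁ z             = inj₂ (x , here refl , trans (cong (suc x ⊔_) z) (⊔-identityʳ (suc x)))
  ... | inj₂ e | inj₂ (y , y∈ , e′) = inj₂ (y , there y∈ , trans e e′)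

  maxSuc-++ : ∀ xs ys → maxSuc (xs ++ ys) ≡ maxSuc xs ⊔ maxSuc ys
  maxSuc-++ []       ys = refl
  maxSuc-++ (x ∷ xs) ys = trans (cong (suc x ⊔_) (maxSuc-++ xs ys)) (sym (⊔-assoc (suc x) (maxSuc xs) (maxSuc ys)))

  maxSuc-∷ʳ : ∀ xs x → maxSuc (xs ++ [ x ]) ≡ maxSuc xs ⊔ suc x
  maxSuc-∷ʳ xs x = trans (maxSuc-++ xs [ x ]) (cong (maxSuc xs ⊔_) (⊔-identityʳ (suc x)))

  maxSuc-reverse : ∀ xs → maxSuc (reverse xs) ≡ maxSuc xs
  maxSuc-reverse []       = refl
  maxSuc-reverse (x ∷ xs) = begin
    maxSuc (reverse (x ∷ xs))          ≡⟨ cong maxSuc (unfold-reverse x xs) ⟩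
    maxSuc (reverse xs ++ [ x ])       ≡⟨ maxSuc-∷ʳ (reverse xs) x ⟩
    maxSuc (reverse xs) ⊔ suc x        ≡⟨ cong (_⊔ suc x) (maxSuc-reverse xs) ⟩
    maxSuc xs ⊔ suc x                  ≡⟨ ⊔-comm (maxSuc xs) (suc x) ⟩
    maxSuc (x ∷ xs)                    ∎
    where open ≡-Reasoning

  distinct⇒length≤maxSuc : ∀ {xs} → Distinct xs → length xs ≤ maxSuc xs
  distinct⇒length≤maxSuc ds = distinct-bounded⇒length≤ ds ∈⇒<maxSuc

  infix 4 _[_]=_

  data _[_]=_ {A : Set} : List A → ℕ → A → Set where
    here  : ∀ {x xs} → (x ∷ xs) [ 0 ]= x
    there : ∀ {y xs i x} → xs [ i ]= x → (y ∷ xs) [ suc i ]= x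

  private
    variable
      i j : ℕ

  []=-functional : xs [ i ]= x → xs [ i ]= y → x ≡ y
  []=-functional here      here      = refl
  []=-functional (there p) (there q) = []=-functional p q

  []=⇒<length : xs [ i ]= x → i < length xs
  []=⇒<length here      = s≤s z≤n
  []=⇒<length (there p) = s≤s ([]=⇒<length p)

  []=⇒∈ : xs [ i ]= x → x ∈ xs
  []=⇒∈ here      = here refl
  []=⇒∈ (there p) = there ([]=⇒∈ p)

  distinct-[]=-injective : Distinct xs → xs [ i ]= x → xs [ j ]= x → i ≡ j
  distinct-[]=-injective _         here      here      = refl
  distinct-[]=-injective (x∉ , _)  here      (there q) = ⊥-elim (x∉ ([]=⇒∈ q))
  distinct-[]=-injective (x∉ , _)  (there p) here      = ⊥-elim (x∉ ([]=⇒∈ p))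
  distinct-[]=-injective (_ , ds)  (there p) (there q) = cong suc (distinct-[]=-injective ds p q)

  []=-++⁺ʳ : ∀ xs → ys [ j ]= y → (xs ++ ys) [ length xs + j ]= y
  []=-++⁺ʳ []       p = p
  []=-++⁺ʳ (x ∷ xs) p = there ([]=-++⁺ʳ xs p)

  []=-middle : ∀ xs → (xs ++ x ∷ ys) [ length xs ]= x
  []=-middle {x = x} {ys = ys} xs =
    subst ((xs ++ x ∷ ys) [_]= x) (+-identityʳ (length xs)) ([]=-++⁺ʳ xs here)

  []=-++⁻ʳ : ∀ xs → (xs ++ x ∷ ys) [ j ]= y → length xs < j → ys [ j ∸ suc (length xs) ]= y
  []=-++⁻ʳ []       (there p) _       = p
  []=-++⁻ʳ (x ∷ xs) (there p) (s≤s q) = []=-++⁻ʳ xs p q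

  []=⇒split : xs [ i ]= x → ∃ λ us → ∃ λ vs → xs ≡ us ++ x ∷ vs × length us ≡ i
  []=⇒split {xs = x ∷ xs} here = [] , xs , refl , refl
  []=⇒split {xs = y ∷ xs} (there p) with []=⇒split p
  ... | us , vs , refl , refl = y ∷ us , vs , refl , refl

  []=-reverse : xs [ i ]= x → reverse xs [ length xs ∸ suc i ]= x
  []=-reverse {xs = xs} {x = x} p with []=⇒split p
  ... | us , vs , refl , refl =
    subst₂ (λ zs k → zs [ k ]= x) (sym reverse-split) (sym index) ([]=-middle (reverse vs))
    where
    reverse-split : reverse (us ++ x ∷ vs) ≡ reverse vs ++ x ∷ reverse us
    reverse-split = begin
      reverse (us ++ x ∷ vs)              ≡⟨ reverse-++ us (x ∷ vs) ⟩
      reverse (x ∷ vs) ++ reverse us      ≡⟨ cong (_++ reverse us) (unfold-reverse x vs) ⟩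
      (reverse vs ++ [ x ]) ++ reverse us ≡⟨ ++-assoc (reverse vs) [ x ] (reverse us) ⟩
      reverse vs ++ x ∷ reverse us        ∎
      where open ≡-Reasoning
    index : length (us ++ x ∷ vs) ∸ suc (length us) ≡ length (reverse vs)
    index = begin
      length (us ++ x ∷ vs) ∸ suc (length us)     ≡⟨ cong (_∸ suc (length us)) (length-++ us) ⟩
      length us + suc (length vs) ∸ suc (length us) ≡⟨ cong (_∸ suc (length us)) (+-suc (length us) (length vs)) ⟩
      suc (length us + length vs) ∸ suc (length us) ≡⟨ m+n∸m≡n (length us) (length vs) ⟩
      length vs                                   ≡⟨ length-reverse vs ⟨
      length (reverse vs)                         ∎
      where open ≡-Reasoning

  ∈⇒[]= : x ∈ xs → ∃ λ i → xs [ i ]= x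
  ∈⇒[]= (here refl) = 0 , here
  ∈⇒[]= (there p) with ∈⇒[]= p
  ... | i , q = suc i , there q

  []=-map⁺ : ∀ {B : Set} (f : A → B) → xs [ i ]= x → map f xs [ i ]= f x
  []=-map⁺ f here      = here
  []=-map⁺ f (there p) = there ([]=-map⁺ f p)

  []=-map⁻ : ∀ {B : Set} (f : A → B) {y} → map f xs [ i ]= y → ∃ λ x → xs [ i ]= x × y ≡ f x
  []=-map⁻ {xs = x ∷ xs} f here      = x , here , refl
  []=-map⁻ {xs = x ∷ xs} f (there p) with []=-map⁻ f p
  ... | z , q , e = z , there q , e

  lookupOr : A → List A → ℕ → A
  lookupOr d []       i       = d
  lookupOr d (x ∷ xs) zero    = x
  lookupOr d (x ∷ xs) (suc i) = lookupOr d xs i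

  lookupOr-[]= : (d : A) (xs : List A) → i < length xs → xs [ i ]= lookupOr d xs i
  lookupOr-[]= {i = zero}  d (x ∷ xs) _       = here
  lookupOr-[]= {i = suc i} d (x ∷ xs) (s≤s p) = there (lookupOr-[]= d xs p)

  []=⇒lookupOr : (d : A) → xs [ i ]= x → lookupOr d xs i ≡ x
  []=⇒lookupOr d p = []=-functional (lookupOr-[]= d _ ([]=⇒<length p)) p

  indexOf : List ℕ → ℕ → ℕ
  indexOf []       v = 0
  indexOf (x ∷ xs) v with x ≟ v
  ... | yes _ = 0
  ... | no  _ = suc (indexOf xs v)

  indexOf-[]= : ∀ {v} xs → v ∈ xs → xs [ indexOf xs v ]= v
  indexOf-[]= {v} (x ∷ xs) p with x ≟ v
  ... | yes refl = here
  indexOf-[]= (x ∷ xs) (here refl) | no x≢v = ⊥-elim (x≢v refl)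
  indexOf-[]= (x ∷ xs) (there p)   | no _   = there (indexOf-[]= xs p)

  []=-extensional : length xs ≡ length ys → (∀ {i x} → xs [ i ]= x → ys [ i ]= x) → xs ≡ ys
  []=-extensional {xs = []}     {[]}     _ _  = refl
  []=-extensional {xs = x ∷ xs} {y ∷ ys} e sub with sub here
  ... | here = cong (x ∷_) ([]=-extensional (suc-injective e) (λ p → tail (sub (there p))))
    where
    tail : ∀ {z zs i v} → (z ∷ zs) [ suc i ]= v → zs [ i ]= v
    tail (there p) = p

  applyUpTo-[]= : ∀ (f : ℕ → A) {n k} → k < n → applyUpTo f n [ k ]= f k
  applyUpTo-[]= f {suc n} {zero}  _       = here
  applyUpTo-[]= f {suc n} {suc k} (s≤s p) = there (applyUpTo-[]= (f ∘ suc) p)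

  applyUpTo-[]=⁻ : ∀ (f : ℕ → A) {n k v} → applyUpTo f n [ k ]= v → k < n × v ≡ f k
  applyUpTo-[]=⁻ f {suc n} here = s≤s z≤n , refl
  applyUpTo-[]=⁻ f {suc n} (there p) with applyUpTo-[]=⁻ (f ∘ suc) p
  ... | k<n , e = s≤s k<n , e

  applyUpTo-cong : ∀ (f g : ℕ → A) n → (∀ {k} → k < n → f k ≡ g k) → applyUpTo f n ≡ applyUpTo g n
  applyUpTo-cong f g zero    _  = refl
  applyUpTo-cong f g (suc n) eq = cong₂ _∷_ (eq (s≤s z≤n)) (applyUpTo-cong (f ∘ suc) (g ∘ suc) n (λ p → eq (s≤s p)))

  applyUpTo-unique : ∀ (f : ℕ → A) n → length xs ≡ n → (∀ {k} → k < n → xs [ k ]= f k) → applyUpTo f n ≡ xs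
  applyUpTo-unique f n refl entries =
    []=-extensional (length-applyUpTo f n)
      (λ p → let k<n , e = applyUpTo-[]=⁻ f p in subst (_ [ _ ]=_) (sym e) (entries k<n))

  distinct-applyUpTo : ∀ (f : ℕ → A) n → (∀ {k k′} → k < n → k′ < n → f k ≡ f k′ → k ≡ k′) → Distinct (applyUpTo f n)
  distinct-applyUpTo f zero    _   = tt
  distinct-applyUpTo f (suc n) inj = f0∉ , distinct-applyUpTo (f ∘ suc) n (λ p p′ e → suc-injective (inj (s≤s p) (s≤s p′) e))
    where
    f0∉ : f 0 ∉ applyUpTo (f ∘ suc) n
    f0∉ p with ∈-applyUpTo⁻ (f ∘ suc) p
    ... | k , k<n , e with inj (s≤s z≤n) (s≤s k<n) e
    ...   | ()

  applyUpTo-pointwise : ∀ {B : Set} {R : A → B → Set} (f : ℕ → A) ys → (∀ {k y} → ys [ k ]= y → R (f k) y) →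
                        Pointwise R (applyUpTo f (length ys)) ys
  applyUpTo-pointwise f []       _ = []
  applyUpTo-pointwise f (y ∷ ys) r = r here ∷ applyUpTo-pointwise (f ∘ suc) ys (λ p → r (there p))

  Pointwise-[]= : ∀ {B : Set} {R : A → B → Set} {ys : List B} {y} → Pointwise R xs ys → xs [ i ]= x → ys [ i ]= y → R x y
  Pointwise-[]= (r ∷ _)  here      here      = r
  Pointwise-[]= (_ ∷ rs) (there p) (there q) = Pointwise-[]= rs p q

module Borders where

  open Lists
  open import Data.Nat
  open import Data.Nat.Properties
  open import Data.List using (List; []; _∷_; _++_; length; replicate; drop)
  open import Data.List.Properties using (length-++; drop-all)
  open import Data.List.Membership.Propositional using (_∈_)
  open import Data.List.Relation.Binary.Pointwise using (Pointwise; []; _∷_)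
  open import Data.List.Relation.Unary.Any using (here; there)
  open import Data.Product using (∃; _×_; _,_; proj₂)
  open import Data.Sum using (inj₁; inj₂)
  open import Data.Empty using (⊥-elim)
  open import Data.Unit using (⊤; tt)
  open import Relation.Binary.PropositionalEquality

  -- Rows are listed from top to bottom, so the row lengths of a Ferrers board ascend.
  Ascending : ℕ → List ℕ → Set
  Ascending a []       = ⊤
  Ascending a (l ∷ ls) = a ≤ l × Ascending l ls

  ascending⇒lowerBound : ∀ {a ls} → Ascending a ls → ∀ {l} → l ∈ ls → a ≤ l
  ascending⇒lowerBound (a≤l , _)  (here refl) = a≤l
  ascending⇒lowerBound (a≤l , as) (there p)   = ≤-trans a≤l (ascending⇒lowerBound as p)

  ∸-suc : ∀ {a l} → a < l → l ∸ a ≡ suc (l ∸ suc a)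
  ∸-suc {zero}  {suc l} _       = refl
  ∸-suc {suc a} {suc l} (s≤s p) = ∸-suc p

  borderTB-E : ∀ {a l} ls → a < l → borderTB a (l ∷ ls) ≡ E ∷ borderTB (suc a) (l ∷ ls)
  borderTB-E ls a<l rewrite ∸-suc a<l = refl

  borderTB-S : ∀ l ls → borderTB l (l ∷ ls) ≡ S ∷ borderTB l ls
  borderTB-S l ls rewrite n∸n≡0 l = refl

  data NextStep (a : ℕ) : List ℕ → Set where
    stop  : NextStep a []
    east  : ∀ {l ls} → a < l → NextStep a (l ∷ ls)
    south : ∀ {ls} → NextStep a (a ∷ ls)

  nextStep : ∀ {a} ls → Ascending a ls → NextStep a ls
  nextStep []       _         = stop
  nextStep (l ∷ ls) (a≤l , _) with m≤n⇒m<n∨m≡n a≤l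
  ... | inj₁ a<l  = east a<l
  ... | inj₂ refl = south

  NotAboveFrom : ℕ → ℕ → List Step → List Step → Set
  NotAboveFrom a b p q = ∀ k → a + #Eprefix k p ≤ b + #Eprefix k q

  notAboveFrom-EE : ∀ {a b p q} → NotAboveFrom a b (E ∷ p) (E ∷ q) → NotAboveFrom (suc a) (suc b) p q
  notAboveFrom-EE {a} {b} na k = subst₂ _≤_ (+-suc a _) (+-suc b _) (na (suc k))

  notAboveFrom-ES : ∀ {a b p q} → NotAboveFrom a b (E ∷ p) (S ∷ q) → NotAboveFrom (suc a) b p q
  notAboveFrom-ES {a} {b} {p} {q} na k = subst (_≤ b + #Eprefix k q) (+-suc a (#Eprefix k p)) (na (suc k))

  notAboveFrom-SE : ∀ {a b p q} → NotAboveFrom a b (S ∷ p) (E ∷ q) → NotAboveFrom a (suc b) p q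
  notAboveFrom-SE {a} {b} {p} {q} na k = subst (a + #Eprefix k p ≤_) (+-suc b (#Eprefix k q)) (na (suc k))

  notAboveFrom-SS : ∀ {a b p q} → NotAboveFrom a b (S ∷ p) (S ∷ q) → NotAboveFrom a b p q
  notAboveFrom-SS na k = na (suc k)

  drop-tail : ∀ {R : ℕ → ℕ → Set} {l ls} d ys → Pointwise R (l ∷ ls) (drop d ys) → Pointwise R ls (drop (suc d) ys)
  drop-tail zero    (y ∷ ys) (_ ∷ p) = p
  drop-tail (suc d) (y ∷ ys) p       = drop-tail d ys p

  drop-cons : ∀ d {l ls} ys → length ys ≡ suc (length ls) + d → (∀ {y} → y ∈ ys → l ≤ y) →
              Pointwise _≤_ ls (drop (suc d) ys) → Pointwise _≤_ (l ∷ ls) (drop d ys)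
  drop-cons zero    (y ∷ ys) _ l≤ p = l≤ (here refl) ∷ p
  drop-cons (suc d) {ls = ls} (y ∷ ys) e l≤ p =
    drop-cons d ys (trans (suc-injective e) (+-suc (length ls) d)) (λ q → l≤ (there q)) p

  -- Two borders on a common antidiagonal: the second one is d steps further east and has d more rows left.
  rowsBelow⇒notAbove : ∀ {a b} d ts ts′ → d + a ≡ b → Ascending a ts → Ascending b ts′ →
                       length ts′ ≡ length ts + d → Pointwise _≤_ ts (drop d ts′) →
                       NotAboveFrom a b (borderTB a ts) (borderTB b ts′)
  rowsBelow⇒notAbove {a} {b} d ts ts′ e _ _ _ _ zero
    rewrite +-identityʳ a | +-identityʳ b = subst (a ≤_) e (m≤n+m a d)
  rowsBelow⇒notAbove {a} {b} d [] ts′ e _ _ _ _ (suc k)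
    rewrite +-identityʳ a = ≤-trans (subst (a ≤_) e (m≤n+m a d)) (m≤m+n b _)
  rowsBelow⇒notAbove d (l ∷ ls) [] e _ _ () _ (suc k)
  rowsBelow⇒notAbove {a} {b} d (l ∷ ls) (l′ ∷ ls′) e as as′ len pw (suc k)
    with nextStep (l ∷ ls) as | nextStep (l′ ∷ ls′) as′
  ... | east a<l | east b<l′
    rewrite borderTB-E ls a<l | borderTB-E ls′ b<l′ = subst₂ _≤_ (sym (+-suc a _)) (sym (+-suc b _))
      (rowsBelow⇒notAbove d (l ∷ ls) (l′ ∷ ls′) (trans (+-suc d a) (cong suc e))
         (a<l , proj₂ as) (b<l′ , proj₂ as′) len pw k)
  ... | east a<l | south with d
  ...   | zero with pw
  ...     | l≤b ∷ _ rewrite sym e = ⊥-elim (<⇒≱ a<l l≤b)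
  rowsBelow⇒notAbove {a} d (l ∷ ls) (l′ ∷ ls′) e as as′ len pw (suc k) | east a<l | south | suc d′
    rewrite borderTB-E ls a<l | borderTB-S l′ ls′ = ≤-trans (≤-reflexive (+-suc a _))
      (rowsBelow⇒notAbove d′ (l ∷ ls) ls′ (trans (+-suc d′ a) e) (a<l , proj₂ as) (proj₂ as′)
         (suc-injective (trans len (+-suc (suc (length ls)) d′))) pw k)
  rowsBelow⇒notAbove {b = b} d (l ∷ ls) (l′ ∷ ls′) e as as′ len pw (suc k) | south | east b<l′
    rewrite borderTB-S l ls | borderTB-E ls′ b<l′ = ≤-trans
      (rowsBelow⇒notAbove (suc d) ls (l′ ∷ ls′) (cong suc e) (proj₂ as) (b<l′ , proj₂ as′)
         (trans len (sym (+-suc (length ls) d))) (drop-tail d (l′ ∷ ls′) pw) k)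
      (≤-reflexive (sym (+-suc b _)))
  rowsBelow⇒notAbove d (l ∷ ls) (l′ ∷ ls′) e as as′ len pw (suc k) | south | south
    rewrite borderTB-S l ls | borderTB-S l′ ls′ =
      rowsBelow⇒notAbove d ls ls′ e (proj₂ as) (proj₂ as′) (suc-injective len) (drop-tail d (l′ ∷ ls′) pw) k

  length-borderTB-∷ : ∀ a l ls → 0 < length (borderTB a (l ∷ ls))
  length-borderTB-∷ a l ls rewrite length-++ (replicate (l ∸ a) E) {S ∷ borderTB l ls}
                                 | +-suc (length (replicate (l ∸ a) E)) (length (borderTB l ls)) = s≤s z≤n

  -- The recursion is on a bound for the length of the first border (fuel).
  notAbove⇒rowsBelow : ∀ fuel {a b} d ts ts′ → length (borderTB a ts) ≤ fuel → d + a ≡ b →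
                       Ascending a ts → Ascending b ts′ → length ts′ ≡ length ts + d →
                       NotAboveFrom a b (borderTB a ts) (borderTB b ts′) → Pointwise _≤_ ts (drop d ts′)
  notAbove⇒rowsBelow fuel d [] ts′ _ _ _ _ len _ rewrite drop-all d ts′ (≤-reflexive len) = []
  notAbove⇒rowsBelow fuel d (l ∷ ls) [] _ _ _ _ () _
  notAbove⇒rowsBelow zero {a} d (l ∷ ls) (l′ ∷ ls′) fl _ _ _ _ _ =
    ⊥-elim (<⇒≱ (length-borderTB-∷ a l ls) fl)
  notAbove⇒rowsBelow (suc fuel) {a} {b} d (l ∷ ls) (l′ ∷ ls′) fl e as as′ len na
    with nextStep (l ∷ ls) as | nextStep (l′ ∷ ls′) as′
  ... | east a<l | east b<l′ =
    notAbove⇒rowsBelow fuel d (l ∷ ls) (l′ ∷ ls′) (s≤s⁻¹ (subst (λ p → length p ≤ suc fuel) (borderTB-E ls a<l) fl))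
      (trans (+-suc d a) (cong suc e)) (a<l , proj₂ as) (b<l′ , proj₂ as′) len
      (notAboveFrom-EE (subst₂ (NotAboveFrom a b) (borderTB-E ls a<l) (borderTB-E ls′ b<l′) na))
  ... | east a<l | south with d | subst₂ (NotAboveFrom a b) (borderTB-E ls a<l) (borderTB-S l′ ls′) na
  ...   | zero    | na′ rewrite sym e = ⊥-elim (<-irrefl refl (subst₂ _≤_ (+-comm a 1) (+-identityʳ a) (na′ 1)))
  ...   | suc d′  | na′ =
    notAbove⇒rowsBelow fuel d′ (l ∷ ls) ls′ (s≤s⁻¹ (subst (λ p → length p ≤ suc fuel) (borderTB-E ls a<l) fl))
      (trans (+-suc d′ a) e) (a<l , proj₂ as) (proj₂ as′)
      (suc-injective (trans len (+-suc (suc (length ls)) d′))) (notAboveFrom-ES na′)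
  notAbove⇒rowsBelow (suc fuel) {a} {b} d (l ∷ ls) (l′ ∷ ls′) fl e as as′ len na | south | east b<l′ =
    drop-cons d (l′ ∷ ls′) len (λ q → ≤-trans (subst (l ≤_) e (m≤n+m l d)) (ascending⇒lowerBound as′ q))
      (notAbove⇒rowsBelow fuel (suc d) ls (l′ ∷ ls′) (s≤s⁻¹ (subst (λ p → length p ≤ suc fuel) (borderTB-S l ls) fl))
        (cong suc e) (proj₂ as) (b<l′ , proj₂ as′) (trans len (sym (+-suc (length ls) d)))
        (notAboveFrom-SE (subst₂ (NotAboveFrom l b) (borderTB-S l ls) (borderTB-E ls′ b<l′) na)))
  notAbove⇒rowsBelow (suc fuel) {a} {b} d (l ∷ ls) (l′ ∷ ls′) fl e as as′ len na | south | south =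
    drop-cons d (l′ ∷ ls′) len (λ q → ≤-trans (subst (l ≤_) e (m≤n+m l d)) (ascending⇒lowerBound as′ q))
      (notAbove⇒rowsBelow fuel d ls ls′ (s≤s⁻¹ (subst (λ p → length p ≤ suc fuel) (borderTB-S l ls) fl))
        e (proj₂ as) (proj₂ as′) (suc-injective len)
        (notAboveFrom-SS (subst₂ (NotAboveFrom l l′) (borderTB-S l ls) (borderTB-S l′ ls′) na)))

  -- Starting with excess h at abscissa a, each row ends with a south step taken at positive excess.
  DyckRows : ℕ → ℕ → List ℕ → Set
  DyckRows h a []       = h ≡ 0
  DyckRows h a (l ∷ ls) = ∃ λ h′ → h + (l ∸ a) ≡ suc h′ × DyckRows h′ l ls

  dyckFrom-replicateE⁺ : ∀ k {h p} → DyckFrom (k + h) p → DyckFrom h (replicate k E ++ p)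
  dyckFrom-replicateE⁺ zero    d = d
  dyckFrom-replicateE⁺ (suc k) {h} {p} d = east (dyckFrom-replicateE⁺ k (subst (λ x → DyckFrom x p) (sym (+-suc k h)) d))

  dyckFrom-replicateE⁻ : ∀ k {h p} → DyckFrom h (replicate k E ++ p) → DyckFrom (k + h) p
  dyckFrom-replicateE⁻ zero    d        = d
  dyckFrom-replicateE⁻ (suc k) {h} {p} (east d) = subst (λ x → DyckFrom x p) (+-suc k h) (dyckFrom-replicateE⁻ k d)

  dyckRows⇒dyckFrom : ∀ {h a ts} → Ascending a ts → DyckRows h a ts → DyckFrom h (borderTB a ts)
  dyckRows⇒dyckFrom {ts = []}     _        refl = done
  dyckRows⇒dyckFrom {h} {a} {l ∷ ls} (_ , as) (h′ , e , dr) =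
    dyckFrom-replicateE⁺ (l ∸ a)
      (subst (λ x → DyckFrom x (S ∷ borderTB l ls)) (sym (trans (+-comm (l ∸ a) h) e)) (south (dyckRows⇒dyckFrom as dr)))

  dyckFrom⇒dyckRows : ∀ {h a ts} → Ascending a ts → DyckFrom h (borderTB a ts) → DyckRows h a ts
  dyckFrom⇒dyckRows {ts = []}     _        done = refl
  dyckFrom⇒dyckRows {h} {a} {l ∷ ls} (_ , as) d with dyckFrom-S⁻ (dyckFrom-replicateE⁻ (l ∸ a) d)
    where
    dyckFrom-S⁻ : ∀ {x p} → DyckFrom x (S ∷ p) → ∃ λ h′ → x ≡ suc h′ × DyckFrom h′ p
    dyckFrom-S⁻ (south d) = _ , refl , d
  ... | h′ , e , d′ = h′ , trans (+-comm h (l ∸ a)) e , dyckFrom⇒dyckRows as d′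

  #S : List Step → ℕ
  #S []      = 0
  #S (E ∷ p) = #S p
  #S (S ∷ p) = suc (#S p)

  dyckFrom-balanced : ∀ {h p} → DyckFrom h p → #E p + h ≡ #S p
  dyckFrom-balanced done                  = refl
  dyckFrom-balanced (east {h} {p} d)      = trans (sym (+-suc (#E p) h)) (dyckFrom-balanced d)
  dyckFrom-balanced (south {h} {p} d)     = trans (+-suc (#E p) h) (cong suc (dyckFrom-balanced d))

  #S-borderTB : ∀ a ts → #S (borderTB a ts) ≡ length ts
  #S-borderTB a []       = refl
  #S-borderTB a (l ∷ ls) = trans (#S-replicateE (l ∸ a)) (cong suc (#S-borderTB l ls))
    where
    #S-replicateE : ∀ k {q} → #S (replicate k E ++ q) ≡ #S q
    #S-replicateE zero    = refl
    #S-replicateE (suc k) = #S-replicateE k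

  rowsOf : ℕ → List Step → List ℕ
  rowsOf a []      = []
  rowsOf a (E ∷ p) = rowsOf (suc a) p
  rowsOf a (S ∷ p) = a ∷ rowsOf a p

  length-rowsOf : ∀ a p → length (rowsOf a p) ≡ #S p
  length-rowsOf a []      = refl
  length-rowsOf a (E ∷ p) = length-rowsOf (suc a) p
  length-rowsOf a (S ∷ p) = cong suc (length-rowsOf a p)

  borderTB-rowsOf : ∀ {h p} → DyckFrom h p → ∀ a → borderTB a (rowsOf a p) ≡ p × Ascending a (rowsOf a p)
  borderTB-rowsOf done a = refl , tt
  borderTB-rowsOf (south {p = p} d) a with borderTB-rowsOf d a
  ... | e , as = trans (borderTB-S a (rowsOf a p)) (cong (S ∷_) e) , ≤-refl , as
  borderTB-rowsOf (east {p = p} d) a with rowsOf (suc a) p | borderTB-rowsOf d (suc a) | rowsOf-nonEmpty d (suc a)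
    where
    rowsOf-nonEmpty : ∀ {h p} → DyckFrom (suc h) p → ∀ a → ∃ λ l → ∃ λ ls → rowsOf a p ≡ l ∷ ls
    rowsOf-nonEmpty (east d)  a = rowsOf-nonEmpty d (suc a)
    rowsOf-nonEmpty (south d) a = a , _ , refl
  ... | .(l ∷ ls) | e , (a<l , as) | l , ls , refl = trans (borderTB-E ls a<l) (cong (E ∷_) e) , <⇒≤ a<l , as

  vertsFrom-replicateE : ∀ {v} k {x y q} → v ∈ vertsFrom (k + x) y q → v ∈ vertsFrom x y (replicate k E ++ q)
  vertsFrom-replicateE zero    p = p
  vertsFrom-replicateE {v} (suc k) {x} {y} {q} p =
    there (vertsFrom-replicateE k (subst (λ z → v ∈ vertsFrom z y q) (sym (+-suc k x)) p))

  borderTB-vertex : ∀ {a ts j t} y → Ascending a ts → ts [ j ]= t → (t , y ∸ j) ∈ vertsFrom a y (borderTB a ts)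
  borderTB-vertex {a} {t ∷ ls} {zero} {t} y (a≤t , _) here =
    vertsFrom-replicateE (t ∸ a) (subst (λ x → (t , y) ∈ vertsFrom x y (S ∷ borderTB t ls)) (sym (m∸n+n≡m a≤t)) (here refl))
  borderTB-vertex {a} {l ∷ ls} {suc j} {t} y (a≤l , as) (there p) =
    vertsFrom-replicateE (l ∸ a) (subst (λ x → (t , y ∸ suc j) ∈ vertsFrom x y (S ∷ borderTB l ls)) (sym (m∸n+n≡m a≤l))
      (there (subst (λ z → (t , z) ∈ vertsFrom l (y ∸ 1) (borderTB l ls)) (∸-+-assoc y 1 j) (borderTB-vertex (y ∸ 1) as p))))

  rowsOf-borderTB : ∀ {a} ts → Ascending a ts → rowsOf a (borderTB a ts) ≡ ts
  rowsOf-borderTB []                 _          = refl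
  rowsOf-borderTB {a} (l ∷ ls) (a≤l , as) = begin
    rowsOf a (replicate (l ∸ a) E ++ S ∷ borderTB l ls)  ≡⟨ rowsOf-replicateE (l ∸ a) ⟩
    rowsOf (l ∸ a + a) (S ∷ borderTB l ls)               ≡⟨ cong (λ x → rowsOf x (S ∷ borderTB l ls)) (m∸n+n≡m a≤l) ⟩
    l ∷ rowsOf l (borderTB l ls)                         ≡⟨ cong (l ∷_) (rowsOf-borderTB ls as) ⟩
    l ∷ ls                                               ∎
    where
    open ≡-Reasoning
    rowsOf-replicateE : ∀ k {a p} → rowsOf a (replicate k E ++ p) ≡ rowsOf (k + a) p
    rowsOf-replicateE zero    = refl
    rowsOf-replicateE (suc k) {a} {p} = trans (rowsOf-replicateE k) (cong (λ x → rowsOf x p) (+-suc k a))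

  borderTB-injective : ∀ {a ts ts′} → Ascending a ts → Ascending a ts′ → borderTB a ts ≡ borderTB a ts′ → ts ≡ ts′
  borderTB-injective {a} {ts} {ts′} as as′ e =
    trans (sym (rowsOf-borderTB ts as)) (trans (cong (rowsOf a) e) (rowsOf-borderTB ts′ as′))

module RunningMaxima where

  open Lists
  open Borders
  open import Data.Nat
  open import Data.Nat.Properties
  open import Data.List using (List; []; _∷_; _++_; [_]; length)
  open import Data.List.Properties using (length-++; ++-assoc; ++-identityʳ; ∷-injectiveˡ; ∷-injectiveʳ)
  open import Data.List.Membership.Propositional using (_∈_; _∉_)
  open import Data.List.Membership.Propositional.Properties using (∈-++⁺ˡ; ∈-++⁺ʳ; ∈-++⁻; ∈-∃++)
  open import Data.List.Membership.DecPropositional _≟_ using (_∈?_)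
  open import Data.List.Relation.Binary.Pointwise using (Pointwise; []; _∷_)
  open import Data.List.Relation.Unary.Any using (here; there)
  open import Data.Product using (_×_; _,_; proj₁; proj₂)
  open import Data.Sum using (_⊎_; inj₁; inj₂)
  import Data.Sum as Sum
  open import Data.Empty using (⊥; ⊥-elim)
  open import Data.Unit using (⊤; tt)
  open import Relation.Nullary using (yes; no)
  open import Relation.Binary.Definitions using (tri<; tri≈; tri>)
  open import Relation.Binary.PropositionalEquality hiding ([_])

  -- For the column list T of a rook placement read from the top row down, runningMax 0 T lists the
  -- row lengths of the smallest Ferrers board containing the rooks.
  runningMax : ℕ → List ℕ → List ℕ
  runningMax a []       = []
  runningMax a (x ∷ xs) = (a ⊔ suc x) ∷ runningMax (a ⊔ suc x) xs

  length-runningMax : ∀ a xs → length (runningMax a xs) ≡ length xs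
  length-runningMax a []       = refl
  length-runningMax a (x ∷ xs) = cong suc (length-runningMax _ xs)

  runningMax-ascending : ∀ a xs → Ascending a (runningMax a xs)
  runningMax-ascending a []       = tt
  runningMax-ascending a (x ∷ xs) = m≤m⊔n a (suc x) , runningMax-ascending (a ⊔ suc x) xs

  runningMax-below : ∀ {a b xs ys} → a ≤ b → Ascending b ys → Pointwise _<_ xs ys → Pointwise _≤_ (runningMax a xs) ys
  runningMax-below         a≤b _           []           = []
  runningMax-below {a} {xs = x ∷ _} a≤b (b≤y , as) (x<y ∷ pw) =
    ⊔-lub (≤-trans a≤b b≤y) x<y ∷ runningMax-below (⊔-lub (≤-trans a≤b b≤y) x<y) as pw

  ++-∷ʳ : ∀ (xs : List ℕ) x ys → (xs ++ [ x ]) ++ ys ≡ xs ++ x ∷ ys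
  ++-∷ʳ xs x ys = ++-assoc xs [ x ] ys

  record Pattern312 (T : List ℕ) : Set where
    constructor pattern312
    field
      A B C D : List ℕ
      x y z   : ℕ
      split   : T ≡ A ++ x ∷ B ++ y ∷ C ++ z ∷ D
      y<z     : y < z
      z<x     : z < x

  record Pattern312At (T : List ℕ) : Set where
    constructor pattern312At
    field
      i j k x y z : ℕ
      i<j         : i < j
      j<k         : j < k
      T[i]=x      : T [ i ]= x
      T[j]=y      : T [ j ]= y
      T[k]=z      : T [ k ]= z
      y<z         : y < z
      z<x         : z < x

  pattern312⇒pattern312At : ∀ {T} → Pattern312 T → Pattern312At T
  pattern312⇒pattern312At (pattern312 A B C D x y z refl y<z z<x) =
    pattern312At (length A) (length A + suc (length B)) (length A + suc (length B + suc (length C))) x y z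
      (m<m+1+n (length A) (length B)) (+-monoʳ-< (length A) (s≤s (m<m+1+n (length B) (length C))))
      ([]=-middle A) ([]=-++⁺ʳ A (there ([]=-middle B))) ([]=-++⁺ʳ A (there ([]=-++⁺ʳ B (there ([]=-middle C))))) y<z z<x
    where
    m<m+1+n : ∀ m n → m < m + suc n
    m<m+1+n m n = subst (m <_) (sym (+-suc m n)) (s≤s (m≤m+n m n))

  pattern312At⇒pattern312 : ∀ {T} → Pattern312At T → Pattern312 T
  pattern312At⇒pattern312 (pattern312At i j k x y z i<j j<k T[i]=x T[j]=y T[k]=z y<z z<x) with []=⇒split T[i]=x
  ... | A , B , refl , refl with []=⇒split ([]=-++⁻ʳ A T[j]=y i<j)
  ...   | C , D , refl , length-C with []=⇒split ([]=-++⁻ʳ C ([]=-++⁻ʳ A T[k]=z (<-trans i<j j<k))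
                                       (subst (_< k ∸ suc (length A)) (sym length-C)
                                         (∸-monoˡ-< j<k i<j)))
  ...     | E′ , G , refl , _ = pattern312 A C E′ G x y z refl y<z z<x

  -- P ++ T has no occurrence of 312 whose 1 lies in T
  Avoids312After : List ℕ → List ℕ → Set
  Avoids312After P []      = ⊤
  Avoids312After P (v ∷ T) = (∀ {w u} → w ∈ P → u ∈ T → v < u → u < w → ⊥) × Avoids312After (P ++ [ v ]) T

  avoids312After-++ : ∀ P X {v} R {w u} → Avoids312After P (X ++ v ∷ R) → w ∈ P ++ X → u ∈ R → v < u → u < w → ⊥
  avoids312After-++ P []      R av w∈ u∈ v<u u<w = proj₁ av (subst (_ ∈_) (++-identityʳ P) w∈) u∈ v<u u<w
  avoids312After-++ P (x ∷ X) R {w} av w∈ u∈ v<u u<w =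
    avoids312After-++ (P ++ [ x ]) X R (proj₂ av) (subst (w ∈_) (sym (++-∷ʳ P x X)) w∈) u∈ v<u u<w

  avoids312⇒¬pattern312 : ∀ {T} → Avoids312After [] T → Pattern312 T → ⊥
  avoids312⇒¬pattern312 av (pattern312 A B C D x y z refl y<z z<x) =
    avoids312After-++ [] (A ++ x ∷ B) (C ++ z ∷ D) (subst (Avoids312After []) (sym (++-assoc A (x ∷ B) (y ∷ C ++ z ∷ D))) av)
      (∈-++⁺ʳ A (here refl)) (∈-++⁺ʳ C (here refl)) y<z z<x

  ¬pattern312⇒avoids312 : ∀ L P T → P ++ T ≡ L → (Pattern312 L → ⊥) → Avoids312After P T
  ¬pattern312⇒avoids312 L P []      _ _  = tt
  ¬pattern312⇒avoids312 L P (v ∷ T) e np = no-occurrence , ¬pattern312⇒avoids312 L (P ++ [ v ]) T (trans (++-∷ʳ P v T) e) np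
    where
    no-occurrence : ∀ {w u} → w ∈ P → u ∈ T → v < u → u < w → ⊥
    no-occurrence w∈ u∈ v<u u<w with ∈-∃++ w∈ | ∈-∃++ u∈
    ... | A , B , refl | C , D , refl =
      np (pattern312 A B C D _ v _ (trans (sym e) (++-assoc A (_ ∷ B) (v ∷ C ++ _ ∷ D))) v<u u<w)

  -- If the running maxima agree at x and at y > x, then y is a later entry and the maximum w
  -- of the common prefix gives an occurrence w x y of 312.
  runningMax-step-injective : ∀ P x xs y ys → maxSuc P ⊔ suc x ≡ maxSuc P ⊔ suc y → x < y →
                              Distinct (P ++ y ∷ ys) → y ∈ P ++ x ∷ xs → Avoids312After P (x ∷ xs) → ⊥
  runningMax-step-injective P x xs y ys e x<y ds y∈ av with ⊔-sel (maxSuc P) (suc x)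
  ... | inj₂ e-x = <⇒≱ x<y (s≤s⁻¹ (subst (suc y ≤_) (trans (sym e) e-x) (m≤n⊔m (maxSuc P) (suc y))))
  ... | inj₁ e-P with ∈-++⁻ P y∈
  ...   | inj₁ y∈P         = distinct-middle P ds y∈P
  ...   | inj₂ (here refl) = <-irrefl refl x<y
  ...   | inj₂ (there y∈xs) with maxSuc-attained P
  ...     | inj₁ m≡0 = <⇒≱ (subst (suc y ≤_) (trans (trans (sym e) e-P) m≡0) (m≤n⊔m _ (suc y))) z≤n
  ...     | inj₂ (w , w∈P , m≡w) =
    proj₁ av w∈P y∈xs x<y (≤∧≢⇒< (s≤s⁻¹ (subst (suc y ≤_) (trans (trans (sym e) e-P) m≡w) (m≤n⊔m _ (suc y))))
                                   (λ { refl → distinct-middle P ds w∈P }))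

  runningMax-injective : ∀ P xs ys → Distinct (P ++ xs) → Distinct (P ++ ys) →
                         (∀ {v} → v ∈ P ++ xs → v ∈ P ++ ys) → (∀ {v} → v ∈ P ++ ys → v ∈ P ++ xs) →
                         Avoids312After P xs → Avoids312After P ys →
                         runningMax (maxSuc P) xs ≡ runningMax (maxSuc P) ys → xs ≡ ys
  runningMax-injective P []       []       _ _ _ _ _ _ _ = refl
  runningMax-injective P (x ∷ xs) (y ∷ ys) dx dy xs⊆ys ys⊆xs avx avy eq with <-cmp x y
  ... | tri< x<y _ _ = ⊥-elim (runningMax-step-injective P x xs y ys (∷-injectiveˡ eq) x<y dy
                                 (ys⊆xs (∈-++⁺ʳ P (here refl))) avx)
  ... | tri> _ _ y<x = ⊥-elim (runningMax-step-injective P y ys x xs (sym (∷-injectiveˡ eq)) y<x dx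
                                 (xs⊆ys (∈-++⁺ʳ P (here refl))) avy)
  ... | tri≈ _ refl _ = cong (x ∷_) (runningMax-injective (P ++ [ x ]) xs ys
          (subst Distinct (sym (++-∷ʳ P x xs)) dx) (subst Distinct (sym (++-∷ʳ P x ys)) dy)
          (λ {v} p → subst (v ∈_) (sym (++-∷ʳ P x ys)) (xs⊆ys (subst (v ∈_) (++-∷ʳ P x xs) p)))
          (λ {v} p → subst (v ∈_) (sym (++-∷ʳ P x xs)) (ys⊆xs (subst (v ∈_) (++-∷ʳ P x ys) p)))
          (proj₂ avx) (proj₂ avy) (subst (λ m → runningMax m xs ≡ runningMax m ys) (sym (maxSuc-∷ʳ P x)) (∷-injectiveʳ eq)))

  private
    excess-before-south : ∀ h p m l → h + p ≡ m → m ≤ l → suc p ≤ l → h + (l ∸ m) ≡ suc (l ∸ suc p)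
    excess-before-south h p m l refl m≤l sp≤l with m≤n⇒∃[o]m+o≡n m≤l
    ... | k , refl = begin
      h + (h + p + k ∸ (h + p))   ≡⟨ cong (h +_) (m+n∸m≡n (h + p) k) ⟩
      h + k                       ≡⟨ m+n∸m≡n p (h + k) ⟨
      p + (h + k) ∸ p             ≡⟨ cong (_∸ p) (+-rearrange p h k) ⟩
      h + p + k ∸ p               ≡⟨ ∸-suc sp≤l ⟩
      suc (h + p + k ∸ suc p)     ∎
      where
      open ≡-Reasoning
      +-rearrange : ∀ p h k → p + (h + k) ≡ h + p + k
      +-rearrange p h k = trans (sym (+-assoc p h k)) (cong (_+ k) (+-comm p h))

    excess-after-south : ∀ h p h′ m l → h + p ≡ m → m ≤ l → h + (l ∸ m) ≡ suc h′ → h′ + suc p ≡ l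
    excess-after-south h p h′ m l hp m≤l e = begin
      h′ + suc p         ≡⟨ +-suc h′ p ⟩
      suc h′ + p         ≡⟨ cong (_+ p) e ⟨
      h + (l ∸ m) + p    ≡⟨ +-assoc h (l ∸ m) p ⟩
      h + ((l ∸ m) + p)  ≡⟨ cong (h +_) (+-comm (l ∸ m) p) ⟩
      h + (p + (l ∸ m))  ≡⟨ +-assoc h p (l ∸ m) ⟨
      h + p + (l ∸ m)    ≡⟨ cong (_+ (l ∸ m)) hp ⟩
      m + (l ∸ m)        ≡⟨ m+[n∸m]≡n m≤l ⟩
      l                  ∎
      where open ≡-Reasoning

    length-∷ʳ : ∀ (P : List ℕ) x → length (P ++ [ x ]) ≡ suc (length P)
    length-∷ʳ P x = trans (length-++ P) (+-comm (length P) 1)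

  -- After the prefix P the border of the running maxima has excess h = maxSuc P − length P; it stays
  -- positive since a distinct list is never longer than its maxSuc.
  runningMax-dyckRows : ∀ P xs h → Distinct (P ++ xs) → h + length P ≡ maxSuc P → maxSuc (P ++ xs) ≡ length (P ++ xs) →
                        DyckRows h (maxSuc P) (runningMax (maxSuc P) xs)
  runningMax-dyckRows P [] h _ e₁ e₂ = +-cancelʳ-≡ (length P) h 0 (trans e₁ (subst (λ Q → maxSuc Q ≡ length Q) (++-identityʳ P) e₂))
  runningMax-dyckRows P (x ∷ xs) h ds e₁ e₂ =
    l ∸ suc (length P) , excess-before-south h (length P) (maxSuc P) l e₁ (m≤m⊔n _ _) length<l ,
    subst (λ m → DyckRows (l ∸ suc (length P)) m (runningMax m xs)) (maxSuc-∷ʳ P x)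
      (runningMax-dyckRows (P ++ [ x ]) xs (l ∸ suc (length P)) ds′
        (trans (cong ((l ∸ suc (length P)) +_) (length-∷ʳ P x)) (trans (m∸n+n≡m length<l) (sym (maxSuc-∷ʳ P x))))
        (subst (λ Q → maxSuc Q ≡ length Q) (sym (++-∷ʳ P x xs)) e₂))
    where
    l = maxSuc P ⊔ suc x
    ds′ : Distinct ((P ++ [ x ]) ++ xs)
    ds′ = subst Distinct (sym (++-∷ʳ P x xs)) ds
    length<l : suc (length P) ≤ l
    length<l = subst₂ _≤_ (length-∷ʳ P x) (maxSuc-∷ʳ P x) (distinct⇒length≤maxSuc (distinct-++⁻ˡ (P ++ [ x ]) ds′))

  largestMissingBelow : List ℕ → ℕ → ℕ
  largestMissingBelow P zero = 0
  largestMissingBelow P (suc k) with k ∈? P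
  ... | yes _ = largestMissingBelow P k
  ... | no  _ = k

  largestMissingBelow-spec : ∀ P c → (∀ {k} → k < c → k ∈ P) ⊎
    (let v = largestMissingBelow P c in v < c × v ∉ P × (∀ {u} → v < u → u < c → u ∈ P))
  largestMissingBelow-spec P zero = inj₁ (λ ())
  largestMissingBelow-spec P (suc k) with k ∈? P
  ... | no k∉ = inj₂ (≤-refl , k∉ , λ k<u u<sk → ⊥-elim (<⇒≱ k<u (s≤s⁻¹ u<sk)))
  ... | yes k∈ with largestMissingBelow-spec P k
  ...   | inj₁ all-below = inj₁ λ k′<sk → Sum.[ all-below , (λ { refl → k∈ }) ] (m<1+n⇒m<n∨m≡n k′<sk)
  ...   | inj₂ (v<k , v∉ , above) = inj₂ (m<n⇒m<1+n v<k , v∉ ,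
            λ v<u u<sk → Sum.[ above v<u , (λ { refl → k∈ }) ] (m<1+n⇒m<n∨m≡n u<sk))

  -- A 312-avoiding entry that does not raise the running maximum c must be the largest value below c
  -- not used so far; one that raises it to l must be l − 1.
  nextEntry : List ℕ → ℕ → ℕ → ℕ
  nextEntry P c l with c <? l
  ... | yes _ = l ∸ 1
  ... | no  _ = largestMissingBelow P c

  fromRunningMax : List ℕ → ℕ → List ℕ → List ℕ
  fromRunningMax P c []       = []
  fromRunningMax P c (l ∷ ls) = nextEntry P c l ∷ fromRunningMax (P ++ [ nextEntry P c l ]) l ls

  record Reconstructs (P : List ℕ) (c : ℕ) (ls T : List ℕ) : Set where
    field
      runningMax-eq : runningMax c T ≡ ls
      distinct      : Distinct (P ++ T)
      avoids        : Avoids312After P T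
      below         : Pointwise _<_ T ls
      maxSuc≡length : maxSuc (P ++ T) ≡ length (P ++ T)

  reconstructs-∷ : ∀ {P c l ls v T} → Reconstructs (P ++ [ v ]) l ls T →
                   c ⊔ suc v ≡ l → v < l → (∀ {w u} → w ∈ P → u ∈ T → v < u → u < w → ⊥) →
                   Reconstructs P c (l ∷ ls) (v ∷ T)
  reconstructs-∷ {P} {v = v} {T} r cv≡l v<l no-occurrence = record
    { runningMax-eq = trans (cong (λ m → m ∷ runningMax m T) cv≡l) (cong (_ ∷_) runningMax-eq)
    ; distinct      = subst Distinct (++-∷ʳ P v T) distinct
    ; avoids        = no-occurrence , avoids
    ; below         = v<l ∷ below
    ; maxSuc≡length = subst (λ Q → maxSuc Q ≡ length Q) (++-∷ʳ P v T) maxSuc≡length }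
    where open Reconstructs r

  NoOccurrenceAt : List ℕ → ℕ → List ℕ → Set
  NoOccurrenceAt P v T = ∀ {w u} → w ∈ P → u ∈ T → v < u → u < w → ⊥

  fromRunningMax-reconstructs : ∀ {P c h} ls → Ascending c ls → DyckRows h c ls → Distinct P → c ≡ maxSuc P →
                                h + length P ≡ c → Reconstructs P c ls (fromRunningMax P c ls)

  fromRunningMax-step : ∀ {P c h h′ l} ls v → Ascending l ls → DyckRows h′ l ls → Distinct P → c ≡ maxSuc P →
                        h + length P ≡ c → h + (l ∸ c) ≡ suc h′ → c ≤ l → c ⊔ suc v ≡ l → v < l → v ∉ P →
                        (Distinct ((P ++ [ v ]) ++ fromRunningMax (P ++ [ v ]) l ls) →
                           NoOccurrenceAt P v (fromRunningMax (P ++ [ v ]) l ls)) →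
                        Reconstructs P c (l ∷ ls) (v ∷ fromRunningMax (P ++ [ v ]) l ls)
  fromRunningMax-step {P} {c} {h} {h′} {l} ls v as dr ds c≡max hp e c≤l cv≡l v<l v∉P no-occurrence =
    reconstructs-∷ r cv≡l v<l (no-occurrence (Reconstructs.distinct r))
    where
    r = fromRunningMax-reconstructs ls as dr (distinct-∷ʳ P ds v∉P)
          (trans (sym cv≡l) (trans (cong (_⊔ suc v) c≡max) (sym (maxSuc-∷ʳ P v))))
          (trans (cong (h′ +_) (length-∷ʳ P v)) (excess-after-south h (length P) h′ c l hp c≤l e))

  fromRunningMax-reconstructs {P} {c} {h} [] _ dr ds c≡max hp = record
    { runningMax-eq = refl
    ; distinct      = subst Distinct (sym (++-identityʳ P)) ds
    ; avoids        = tt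
    ; below         = []
    ; maxSuc≡length = subst (λ Q → maxSuc Q ≡ length Q) (sym (++-identityʳ P))
                        (trans (sym c≡max) (trans (sym hp) (cong (_+ length P) dr))) }
  fromRunningMax-reconstructs {P} {c} {h} (l ∷ ls) (c≤l , as) (h′ , e , dr) ds c≡max hp with c <? l
  ... | yes c<l@(s≤s {n = l-1} c≤l-1) =
    fromRunningMax-step ls l-1 as dr ds c≡max hp e c≤l (m≤n⇒m⊔n≡n (<⇒≤ c<l)) ≤-refl l-1∉P
      (λ _ w∈P _ l-1<u u<w → <-asym (<-≤-trans (∈⇒<maxSuc w∈P) (≤-trans (≤-reflexive (sym c≡max)) c≤l-1))
                                    (<-trans l-1<u u<w))
    where
    l-1∉P : l-1 ∉ P
    l-1∉P p = <⇒≱ (subst (l-1 <_) (sym c≡max) (∈⇒<maxSuc p)) c≤l-1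
  ... | no c≮l with ≤-antisym c≤l (≮⇒≥ c≮l)
  ...   | refl with largestMissingBelow-spec P c
  ...     | inj₁ all-below = ⊥-elim (<⇒≱ length<c (⊇below⇒≤length all-below))
    where
    h≡1+h′ : h ≡ suc h′
    h≡1+h′ = trans (sym (+-identityʳ h)) (trans (cong (h +_) (sym (n∸n≡0 c))) e)
    length<c : length P < c
    length<c = ≤-trans (s≤s (m≤n+m (length P) h′)) (≤-reflexive (trans (cong (_+ length P) (sym h≡1+h′)) hp))
  ...     | inj₂ (v<c , v∉P , above) =
    fromRunningMax-step ls v as dr ds c≡max hp e c≤l (m≥n⇒m⊔n≡m v<c) v<c v∉P
      (λ ds′ w∈P u∈ v<u u<w → distinct-++⇒disjoint (P ++ [ v ]) ds′
                               (∈-++⁺ˡ (above v<u (<-trans u<w (subst (_ <_) (sym c≡max) (∈⇒<maxSuc w∈P))))) u∈)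
    where v = largestMissingBelow P c

module Core where

  open Lists
  open Borders
  open RunningMaxima
  open import Data.Nat
  open import Data.Nat.Properties
  open import Data.List using (List; []; length)
  open import Data.List.Membership.Propositional using (_∈_)
  open import Data.List.Relation.Binary.Pointwise as Pointwise using (Pointwise)
  open import Data.Product using (∃; _×_; _,_; proj₁; proj₂)
  open import Data.Unit using (tt)
  open import Relation.Nullary using (¬_)
  open import Relation.Binary.PropositionalEquality

  -- the column list, from the top row down, of a 213-avoiding full rook placement on the board with rows ts
  record Admissible (n : ℕ) (ts T : List ℕ) : Set where
    field
      distinct  : Distinct T
      bounded   : ∀ {x} → x ∈ T → x < n
      length≡n  : length T ≡ n
      inBoard   : Pointwise _<_ T ts
      avoids312 : ¬ Pattern312 T

  runningBorder : List ℕ → List Step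
  runningBorder T = borderTB 0 (runningMax 0 T)

  module OnRows (n : ℕ) (ts : List ℕ) (ts-ascending : Ascending 0 ts) (length-ts : length ts ≡ n) where

    runningBorder-dyck-below : ∀ {T} → Admissible n ts T → IsDyck n (runningBorder T) × NotAbove (runningBorder T) (borderTB 0 ts)
    runningBorder-dyck-below {T} adm = (dyck , #E≡n) , below
      where
      open Admissible adm
      length-runningMax-T : length (runningMax 0 T) ≡ n
      length-runningMax-T = trans (length-runningMax 0 T) length≡n
      dyck : DyckFrom 0 (runningBorder T)
      dyck = dyckRows⇒dyckFrom (runningMax-ascending 0 T)
               (runningMax-dyckRows [] T 0 distinct refl
                 (≤-antisym (subst (maxSuc T ≤_) (sym length≡n) (maxSuc≤ T bounded)) (distinct⇒length≤maxSuc distinct)))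
      #E≡n : #E (runningBorder T) ≡ n
      #E≡n = begin
        #E (runningBorder T)          ≡⟨ +-identityʳ _ ⟨
        #E (runningBorder T) + 0      ≡⟨ dyckFrom-balanced dyck ⟩
        #S (runningBorder T)          ≡⟨ #S-borderTB 0 (runningMax 0 T) ⟩
        length (runningMax 0 T)       ≡⟨ length-runningMax-T ⟩
        n                             ∎
        where open ≡-Reasoning
      below : NotAbove (runningBorder T) (borderTB 0 ts)
      below = rowsBelow⇒notAbove 0 (runningMax 0 T) ts refl (runningMax-ascending 0 T) ts-ascending
                (trans length-ts (sym (trans (+-identityʳ _) length-runningMax-T)))
                (runningMax-below z≤n ts-ascending inBoard)

    runningBorder-injective : ∀ {T T′} → Admissible n ts T → Admissible n ts T′ → runningBorder T ≡ runningBorder T′ → T ≡ T′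
    runningBorder-injective {T} {T′} adm adm′ e =
      runningMax-injective [] T T′ distinct (Admissible.distinct adm′)
        (λ p → distinct-bounded-complete (Admissible.distinct adm′) (Admissible.bounded adm′) (Admissible.length≡n adm′) (bounded p))
        (λ p → distinct-bounded-complete distinct bounded length≡n (Admissible.bounded adm′ p))
        (¬pattern312⇒avoids312 T [] T refl avoids312) (¬pattern312⇒avoids312 T′ [] T′ refl (Admissible.avoids312 adm′))
        (borderTB-injective (runningMax-ascending 0 T) (runningMax-ascending 0 T′) e)
      where open Admissible adm

    runningBorder-surjective : ∀ D₀ → IsDyck n D₀ → NotAbove D₀ (borderTB 0 ts) → ∃ λ T → Admissible n ts T × runningBorder T ≡ D₀
    runningBorder-surjective D₀ (dyck , #E≡n) D₀-below = T , admissible , trans (cong (borderTB 0) runningMax-eq) border-rows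
      where
      rows : List ℕ
      rows = rowsOf 0 D₀
      border-rows : borderTB 0 rows ≡ D₀
      border-rows = proj₁ (borderTB-rowsOf dyck 0)
      rows-ascending : Ascending 0 rows
      rows-ascending = proj₂ (borderTB-rowsOf dyck 0)
      length-rows : length rows ≡ n
      length-rows = trans (length-rowsOf 0 D₀) (trans (sym (dyckFrom-balanced dyck)) (trans (+-identityʳ _) #E≡n))
      rows-below : Pointwise _≤_ rows ts
      rows-below = notAbove⇒rowsBelow _ 0 rows ts ≤-refl refl rows-ascending ts-ascending
                     (trans length-ts (sym (trans (+-identityʳ _) length-rows)))
                     (subst (λ p → NotAbove p (borderTB 0 ts)) (sym border-rows) D₀-below)
      T : List ℕ
      T = fromRunningMax [] 0 rows
      open Reconstructs (fromRunningMax-reconstructs {P = []} rows rows-ascending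
                           (dyckFrom⇒dyckRows rows-ascending (subst (DyckFrom 0) (sym border-rows) dyck)) tt refl refl)
      length-T : length T ≡ n
      length-T = trans (Pointwise.Pointwise-length below) length-rows
      admissible : Admissible n ts T
      admissible = record
        { distinct  = distinct
        ; bounded   = λ p → subst (_ <_) (trans maxSuc≡length length-T) (∈⇒<maxSuc p)
        ; length≡n  = length-T
        ; inBoard   = Pointwise.transitive <-≤-trans below rows-below
        ; avoids312 = avoids312⇒¬pattern312 avoids }

module Columns where

  open Lists
  open import Data.Nat
  open import Data.Nat.Properties using (suc-injective)
  open import Data.Fin as Fin using (Fin; toℕ; fromℕ<)
  open import Data.Fin.Properties using (toℕ-injective; toℕ-fromℕ<) renaming (suc-injective to fsuc-injective)
  open import Data.Vec as Vec using (Vec; lookup; toList)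
  open import Data.Vec.Properties using (toList-injective; length-toList)
  open import Data.Vec.Relation.Binary.Equality.Cast using (cast-is-id)
  open import Data.List using (List; []; _∷_; map; length)
  open import Data.List.Properties using (map-injective; length-map)
  open import Data.List.Membership.Propositional using (_∈_; _∉_)
  open import Data.List.Relation.Binary.Pointwise using (Pointwise; []; _∷_)
  open import Data.List.Relation.Unary.Any using (here; there)
  open import Data.Product using (∃; _×_; _,_)
  open import Data.Unit using (tt)
  open import Relation.Binary.PropositionalEquality

  toList-[]= : ∀ {A : Set} {k} (v : Vec A k) j → toList v [ toℕ j ]= lookup v j
  toList-[]= (x Vec.∷ v) Fin.zero    = here
  toList-[]= (x Vec.∷ v) (Fin.suc j) = there (toList-[]= v j)

  toList-[]=⁻ : ∀ {A : Set} {k} (v : Vec A k) {i y} → toList v [ i ]= y → ∃ λ j → toℕ j ≡ i × y ≡ lookup v j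
  toList-[]=⁻ (x Vec.∷ v) here      = Fin.zero , refl , refl
  toList-[]=⁻ (x Vec.∷ v) (there p) with toList-[]=⁻ v p
  ... | j , refl , e = Fin.suc j , refl , e

  columns : ∀ {m k} → Vec (Fin m) k → List ℕ
  columns v = map toℕ (toList v)

  length-columns : ∀ {m k} (v : Vec (Fin m) k) → length (columns v) ≡ k
  length-columns v = trans (length-map toℕ (toList v)) (length-toList v)

  columns-[]= : ∀ {m k} (v : Vec (Fin m) k) j → columns v [ toℕ j ]= toℕ (lookup v j)
  columns-[]= v j = []=-map⁺ toℕ (toList-[]= v j)

  columns-[]=⁻ : ∀ {m k} (v : Vec (Fin m) k) {i y} → columns v [ i ]= y → ∃ λ j → toℕ j ≡ i × y ≡ toℕ (lookup v j)
  columns-[]=⁻ v p with []=-map⁻ toℕ p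
  ... | _ , q , refl with toList-[]=⁻ v q
  ...   | j , e , refl = j , e , refl

  ∈-columns⁻ : ∀ {m k} (v : Vec (Fin m) k) {y} → y ∈ columns v → ∃ λ j → y ≡ toℕ (lookup v j)
  ∈-columns⁻ v p with ∈⇒[]= p
  ... | i , q with columns-[]=⁻ v q
  ...   | j , _ , e = j , e

  LookupInjective : ∀ {m k} → Vec (Fin m) k → Set
  LookupInjective {k = k} v = ∀ (r r′ : Fin k) → lookup v r ≡ lookup v r′ → r ≡ r′

  columns-distinct : ∀ {m k} (v : Vec (Fin m) k) → LookupInjective v → Distinct (columns v)
  columns-distinct Vec.[]      _   = tt
  columns-distinct (x Vec.∷ v) inj = x∉ , columns-distinct v (λ r r′ e → fsuc-injective (inj (Fin.suc r) (Fin.suc r′) e))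
    where
    x∉ : toℕ x ∉ columns v
    x∉ p with ∈-columns⁻ v p
    ... | j , e with inj Fin.zero (Fin.suc j) (toℕ-injective e)
    ...   | ()

  columns-distinct⁻ : ∀ {m k} (v : Vec (Fin m) k) → Distinct (columns v) → LookupInjective v
  columns-distinct⁻ v ds r r′ e =
    toℕ-injective (distinct-[]=-injective ds (columns-[]= v r) (subst (λ c → columns v [ _ ]= toℕ c) (sym e) (columns-[]= v r′)))

  columns-below : ∀ {m k} (v : Vec (Fin m) k) (F : Vec ℕ k) → (∀ r → toℕ (lookup v r) < lookup F r) →
                  Pointwise _<_ (columns v) (toList F)
  columns-below Vec.[]      Vec.[]      _  = []
  columns-below (x Vec.∷ v) (y Vec.∷ F) lt = lt Fin.zero ∷ columns-below v F (λ r → lt (Fin.suc r))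

  columns-below⁻ : ∀ {m k} (v : Vec (Fin m) k) (F : Vec ℕ k) → Pointwise _<_ (columns v) (toList F) →
                   ∀ r → toℕ (lookup v r) < lookup F r
  columns-below⁻ (x Vec.∷ v) (y Vec.∷ F) (p ∷ _)  Fin.zero    = p
  columns-below⁻ (x Vec.∷ v) (y Vec.∷ F) (_ ∷ ps) (Fin.suc r) = columns-below⁻ v F ps r

  columns-injective : ∀ {m k} (v v′ : Vec (Fin m) k) → columns v ≡ columns v′ → v ≡ v′
  columns-injective v v′ e =
    trans (sym (cast-is-id refl v)) (toList-injective refl v v′ (map-injective toℕ-injective e))

  fromColumns : ∀ {m} k (L : List ℕ) → length L ≡ k → (∀ {x} → x ∈ L → x < m) → Vec (Fin m) k
  fromColumns zero    []      _ _   = Vec.[]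
  fromColumns (suc k) (x ∷ L) e bnd = fromℕ< (bnd (here refl)) Vec.∷ fromColumns k L (suc-injective e) (λ p → bnd (there p))

  columns-fromColumns : ∀ {m} k L e (bnd : ∀ {x} → x ∈ L → x < m) → columns (fromColumns k L e bnd) ≡ L
  columns-fromColumns zero    []      e bnd = refl
  columns-fromColumns (suc k) (x ∷ L) e bnd =
    cong₂ _∷_ (toℕ-fromℕ< (bnd (here refl))) (columns-fromColumns k L (suc-injective e) (λ p → bnd (there p)))

module RookPlacements where

  open Lists
  open Borders
  open RunningMaxima
  open Core
  open Columns
  open import Data.Nat
  open import Data.Nat.Properties
  open import Data.Fin using (Fin; toℕ; zero; suc)
  open import Data.Fin.Properties using (toℕ<n; toℕ-injective)
  open import Data.Vec as Vec using (lookup; toList)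
  open import Data.Vec.Properties using (length-toList)
  open import Data.List using (List; []; _∷_; _++_; [_]; map; reverse; length)
  open import Data.List.Properties using (unfold-reverse; map-∘; reverse-involutive; reverse-injective; length-reverse)
  open import Data.List.Relation.Binary.Pointwise as Pointwise using (Pointwise)
  open import Data.List.Membership.Propositional using (_∈_)
  open import Data.List.Relation.Unary.Any using (here; there)
  import Data.List.Relation.Unary.Any.Properties as Any
  open import Data.Product using (∃; _×_; _,_; proj₁)
  open import Data.Empty using (⊥-elim)
  open import Data.Unit using (tt)
  open import Relation.Nullary using (¬_)
  open import Function.Bundles using (_⇔_; mk⇔; Equivalence)
  open import Relation.Binary.PropositionalEquality hiding ([_])
  open import Relation.Binary.Definitions using (tri<; tri≈; tri>)
  open import Function.Base using (_on_; _∋_)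
  open import Function.Definitions using (Bijective)

  suffixMaxSuc : List ℕ → List ℕ
  suffixMaxSuc []      = []
  suffixMaxSuc (y ∷ L) = (suc y ⊔ maxSuc L) ∷ suffixMaxSuc L

  sufmax-map-suc : ∀ L → sufmax (map suc L) ≡ suffixMaxSuc L
  sufmax-map-suc []          = refl
  sufmax-map-suc (y ∷ [])    = cong (_∷ []) (sym (⊔-identityʳ (suc y)))
  sufmax-map-suc (y ∷ z ∷ L) rewrite sufmax-map-suc (z ∷ L) = refl

  runningMax-∷ʳ : ∀ a xs x → runningMax a (xs ++ [ x ]) ≡ runningMax a xs ++ [ (a ⊔ maxSuc xs) ⊔ suc x ]
  runningMax-∷ʳ a []       x = cong (λ m → (m ⊔ suc x) ∷ []) (sym (⊔-identityʳ a))
  runningMax-∷ʳ a (y ∷ xs) x = cong ((a ⊔ suc y) ∷_) (trans (runningMax-∷ʳ (a ⊔ suc y) xs x)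
    (cong (λ m → runningMax (a ⊔ suc y) xs ++ [ m ⊔ suc x ]) (⊔-assoc a (suc y) (maxSuc xs))))

  reverse-suffixMaxSuc : ∀ L → reverse (suffixMaxSuc L) ≡ runningMax 0 (reverse L)
  reverse-suffixMaxSuc []      = refl
  reverse-suffixMaxSuc (y ∷ L) = begin
    reverse (suffixMaxSuc (y ∷ L))                              ≡⟨ unfold-reverse _ (suffixMaxSuc L) ⟩
    reverse (suffixMaxSuc L) ++ [ suc y ⊔ maxSuc L ]            ≡⟨ cong (_++ [ suc y ⊔ maxSuc L ]) (reverse-suffixMaxSuc L) ⟩
    runningMax 0 (reverse L) ++ [ suc y ⊔ maxSuc L ]            ≡⟨ cong (λ m → runningMax 0 (reverse L) ++ [ m ]) last-eq ⟩
    runningMax 0 (reverse L) ++ [ maxSuc (reverse L) ⊔ suc y ]  ≡⟨ runningMax-∷ʳ 0 (reverse L) y ⟨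
    runningMax 0 (reverse L ++ [ y ])                           ≡⟨ cong (runningMax 0) (unfold-reverse y L) ⟨
    runningMax 0 (reverse (y ∷ L))                              ∎
    where
    open ≡-Reasoning
    last-eq : suc y ⊔ maxSuc L ≡ maxSuc (reverse L) ⊔ suc y
    last-eq = trans (⊔-comm (suc y) (maxSuc L)) (cong (_⊔ suc y) (sym (maxSuc-reverse L)))

  columnsTB : ∀ {n} → Placement n → List ℕ
  columnsTB σ = reverse (columns σ)

  DFR≡runningBorder : ∀ {n} (σ : Placement n) → DFR σ ≡ runningBorder (columnsTB σ)
  DFR≡runningBorder σ = cong (borderTB 0) (begin
    reverse (sufmax (map (λ c → suc (toℕ c)) (toList σ)))  ≡⟨ cong (λ L → reverse (sufmax L)) (map-∘ (toList σ)) ⟩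
    reverse (sufmax (map suc (columns σ)))                 ≡⟨ cong reverse (sufmax-map-suc (columns σ)) ⟩
    reverse (suffixMaxSuc (columns σ))                     ≡⟨ reverse-suffixMaxSuc (columns σ) ⟩
    runningMax 0 (columnsTB σ)                             ∎)
    where open ≡-Reasoning

  record Occurrence213 {n} (σ : Placement n) : Set where
    constructor occurrence213
    field
      r₁ r₂ r₃ : Fin n
      r₁<r₂    : toℕ r₁ < toℕ r₂
      r₂<r₃    : toℕ r₂ < toℕ r₃
      σr₂<σr₁  : toℕ (lookup σ r₂) < toℕ (lookup σ r₁)
      σr₁<σr₃  : toℕ (lookup σ r₁) < toℕ (lookup σ r₃)

  module _ {n} (σ : Placement n) where

    private
      length-columnsTB : length (columnsTB σ) ≡ n
      length-columnsTB = trans (length-reverse (columns σ)) (length-columns σ)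

    -- Row r is entry n ∸ suc r of the top-down list.
    columnsTB-[]= : ∀ r → columnsTB σ [ n ∸ suc (toℕ r) ]= toℕ (lookup σ r)
    columnsTB-[]= r = subst (λ m → columnsTB σ [ m ∸ suc (toℕ r) ]= toℕ (lookup σ r)) (length-columns σ) ([]=-reverse (columns-[]= σ r))

    columnsTB-[]=⁻ : ∀ {i x} → columnsTB σ [ i ]= x → ∃ λ r → toℕ r ≡ n ∸ suc i × x ≡ toℕ (lookup σ r)
    columnsTB-[]=⁻ {i} p = columns-[]=⁻ σ
      (subst₂ (λ L m → L [ m ∸ suc i ]= _) (reverse-involutive (columns σ)) length-columnsTB ([]=-reverse p))

    private
      flip-< : ∀ {i j} → i < j → j < n → n ∸ suc j < n ∸ suc i
      flip-< i<j j<n = ∸-monoʳ-< (s≤s i<j) j<n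

    pattern312⇒occurrence213 : Pattern312 (columnsTB σ) → Occurrence213 σ
    pattern312⇒occurrence213 pat with pattern312⇒pattern312At pat
    ... | pattern312At i j k x y z i<j j<k T[i]=x T[j]=y T[k]=z y<z z<x
      with columnsTB-[]=⁻ T[i]=x | columnsTB-[]=⁻ T[j]=y | columnsTB-[]=⁻ T[k]=z
    ... | rᵢ , eᵢ , refl | rⱼ , eⱼ , refl | rₖ , eₖ , refl =
      occurrence213 rₖ rⱼ rᵢ (subst₂ _<_ (sym eₖ) (sym eⱼ) (flip-< j<k k<n))
                             (subst₂ _<_ (sym eⱼ) (sym eᵢ) (flip-< i<j (<-trans j<k k<n))) y<z z<x
      where
      k<n : k < n
      k<n = subst (k <_) length-columnsTB ([]=⇒<length T[k]=z)

    occurrence213⇒pattern312 : Occurrence213 σ → Pattern312 (columnsTB σ)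
    occurrence213⇒pattern312 (occurrence213 r₁ r₂ r₃ r₁<r₂ r₂<r₃ σr₂<σr₁ σr₁<σr₃) =
      pattern312At⇒pattern312 (pattern312At _ _ _ _ _ _ (flip-< r₂<r₃ (toℕ<n r₃)) (flip-< r₁<r₂ (toℕ<n r₂))
        (columnsTB-[]= r₃) (columnsTB-[]= r₂) (columnsTB-[]= r₁) σr₂<σr₁ σr₁<σr₃)

  private
    increasing₃ : (f : Fin 3 → ℕ) → f zero < f (suc zero) → f (suc zero) < f (suc (suc zero)) →
                  ∀ a b → toℕ a < toℕ b → f a < f b
    increasing₃ f p q zero             (suc zero)       _ = p
    increasing₃ f p q zero             (suc (suc zero)) _ = <-trans p q
    increasing₃ f p q (suc zero)       (suc (suc zero)) _ = q
    increasing₃ f p q (suc zero)       (suc zero)       (s≤s ())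
    increasing₃ f p q (suc (suc zero)) (suc zero)       (s≤s ())
    increasing₃ f p q (suc (suc zero)) (suc (suc zero)) (s≤s (s≤s ()))

    increasing⇒reflects : ∀ {k} (f : Fin k → ℕ) → (∀ a b → toℕ a < toℕ b → f a < f b) →
                          ∀ a b → f a < f b ⇔ toℕ a < toℕ b
    increasing⇒reflects f inc a b = mk⇔ reflects (inc a b)
      where
      reflects : f a < f b → toℕ a < toℕ b
      reflects fa<fb with <-cmp (toℕ a) (toℕ b)
      ... | tri< lt _ _ = lt
      ... | tri≈ _ eq _ = ⊥-elim (<-irrefl (cong f (toℕ-injective eq)) fa<fb)
      ... | tri> _ _ gt = ⊥-elim (<-asym fa<fb (inc b a gt))

  rowsTB : ∀ {n} → Board n → List ℕ
  rowsTB F = reverse (toList F)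

  length-rowsTB : ∀ {n} (F : Board n) → length (rowsTB F) ≡ n
  length-rowsTB F = trans (length-reverse (toList F)) (length-toList F)

  rowsTB-ascending : ∀ {n} (F : Board n) → IsFerrers F → Ascending 0 (rowsTB F)
  rowsTB-ascending Vec.[]      _       = tt
  rowsTB-ascending (x Vec.∷ F) ferrers = subst (Ascending 0) (sym (unfold-reverse x (toList F)))
    (ascending-∷ʳ (rowsTB F) (rowsTB-ascending F (λ i j i≤j → ferrers (suc i) (suc j) (s≤s i≤j))) x≥ z≤n)
    where
    ascending-∷ʳ : ∀ {a} ys → Ascending a ys → (∀ {y} → y ∈ ys → y ≤ x) → a ≤ x → Ascending a (ys ++ [ x ])
    ascending-∷ʳ []       _         _  a≤x = a≤x , tt
    ascending-∷ʳ (y ∷ ys) (a≤y , as) ≤x _  = a≤y , ascending-∷ʳ ys as (λ p → ≤x (there p)) (≤x (here refl))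
    x≥ : ∀ {y} → y ∈ rowsTB F → y ≤ x
    x≥ p with ∈⇒[]= (Any.reverse⁻ p)
    ... | i , q with toList-[]=⁻ F q
    ...   | j , _ , refl = ferrers zero (suc j) z≤n

  borderVertex-row : ∀ {n} (F : Board n) → IsFerrers F → ∀ r → BorderVertex F (lookup F r , suc (toℕ r))
  borderVertex-row {n} F ferrers r =
    subst (λ y → (lookup F r , y) ∈ vertsFrom 0 n (border F)) row-height
      (borderTB-vertex n (rowsTB-ascending F ferrers) ([]=-reverse (toList-[]= F r)))
    where
    row-height : n ∸ (length (toList F) ∸ suc (toℕ r)) ≡ suc (toℕ r)
    row-height rewrite length-toList F = m∸[m∸n]≡n (toℕ<n r)

  module _ {n} (σ : Placement n) where

    ¬occurrence213⇒avoids : ∀ {F : Board n} → ¬ Occurrence213 σ → AvoidsR τ213 F σ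
    ¬occurrence213⇒avoids no-occurrence V _ (ρ , _ , increasing , order) =
      no-occurrence (occurrence213 (ρ (suc zero)) (ρ zero) (ρ (suc (suc zero)))
        (Equivalence.from (order (suc zero) zero) (s≤s z≤n))
        (Equivalence.from (order zero (suc (suc zero))) (s≤s (s≤s z≤n)))
        (increasing zero (suc zero) (s≤s z≤n))
        (increasing (suc zero) (suc (suc zero)) (s≤s (s≤s z≤n))))

    -- An occurrence lies in Γ of the border vertex at the right end of its top row r₃.
    avoids⇒¬occurrence213 : ∀ {F : Board n} → IsFerrers F → (∀ r → toℕ (lookup σ r) < lookup F r) →
                            AvoidsR τ213 F σ → ¬ Occurrence213 σ
    avoids⇒¬occurrence213 {F} ferrers inF avoids (occurrence213 r₁ r₂ r₃ r₁<r₂ r₂<r₃ σr₂<σr₁ σr₁<σr₃) =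
      avoids _ (borderVertex-row F ferrers r₃) (ρ , inΓ , increasing , order)
      where
      row : Fin 3 → Fin n
      row zero             = r₁
      row (suc zero)       = r₂
      row (suc (suc zero)) = r₃
      ρ : Fin 3 → Fin n
      ρ a = row (lookup τ213 a)
      increasing : ∀ a b → toℕ a < toℕ b → toℕ (lookup σ (ρ a)) < toℕ (lookup σ (ρ b))
      increasing = increasing₃ (λ a → toℕ (lookup σ (ρ a))) σr₂<σr₁ σr₁<σr₃
      order : ∀ a b → (toℕ (ρ a) < toℕ (ρ b)) ⇔ (toℕ (lookup τ213 a) < toℕ (lookup τ213 b))
      order a b = increasing⇒reflects (λ s → toℕ (row s)) (increasing₃ _ r₁<r₂ r₂<r₃) (lookup τ213 a) (lookup τ213 b)
      inΓ : ∀ a → InΓ (lookup F r₃ , suc (toℕ r₃)) (rook σ (ρ a))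
      inΓ zero             = <-trans (<-trans σr₂<σr₁ σr₁<σr₃) (inF r₃) , s≤s (<⇒≤ r₂<r₃)
      inΓ (suc zero)       = <-trans σr₁<σr₃ (inF r₃) , s≤s (<⇒≤ (<-trans r₁<r₂ r₂<r₃))
      inΓ (suc (suc zero)) = inF r₃ , ≤-refl

  columnsTB-injective : ∀ {n} (σ σ′ : Placement n) → columnsTB σ ≡ columnsTB σ′ → σ ≡ σ′
  columnsTB-injective σ σ′ e = columns-injective σ σ′ (reverse-injective e)

  module _ {n} (F : Board n) (ferrers : IsFerrers F) where

    placement⇒admissible : (R : RF τ213 F) → Admissible n (rowsTB F) (columnsTB (proj₁ R))
    placement⇒admissible (σ , (inF , injective , _) , avoids) = record
      { distinct  = distinct-reverse (columns σ) (columns-distinct σ injective)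
      ; bounded   = λ p → let j , e = ∈-columns⁻ σ (Any.reverse⁻ p) in subst (_< n) (sym e) (toℕ<n (lookup σ j))
      ; length≡n  = trans (length-reverse (columns σ)) (length-columns σ)
      ; inBoard   = Pointwise.reverse⁺ (columns-below σ F inF)
      ; avoids312 = λ p → avoids⇒¬occurrence213 σ {F} ferrers inF avoids (pattern312⇒occurrence213 σ p) }

    admissible⇒placement : ∀ T → Admissible n (rowsTB F) T → ∃ λ (R : RF τ213 F) → columnsTB (proj₁ R) ≡ T
    admissible⇒placement T adm = (σ , (inF , injective , surjective) , avoids) , columnsTB-σ
      where
      open Admissible adm
      bounded′ : ∀ {x} → x ∈ reverse T → x < n
      bounded′ p = bounded (Any.reverse⁻ p)
      length′ : length (reverse T) ≡ n
      length′ = trans (length-reverse T) length≡n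
      σ : Placement n
      σ = fromColumns n (reverse T) length′ bounded′
      columns-σ : columns σ ≡ reverse T
      columns-σ = columns-fromColumns n (reverse T) length′ bounded′
      columnsTB-σ : columnsTB σ ≡ T
      columnsTB-σ = trans (cong reverse columns-σ) (reverse-involutive T)
      inF : ∀ r → toℕ (lookup σ r) < lookup F r
      inF = columns-below⁻ σ F (subst₂ (Pointwise _<_) (sym columns-σ) (reverse-involutive (toList F)) (Pointwise.reverse⁺ inBoard))
      injective : ∀ r r′ → lookup σ r ≡ lookup σ r′ → r ≡ r′
      injective = columns-distinct⁻ σ (subst Distinct (sym columns-σ) (distinct-reverse T distinct))
      surjective : ∀ c → ∃ λ r → lookup σ r ≡ c
      surjective c with ∈-columns⁻ σ (subst (toℕ c ∈_) (sym columns-σ)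
                          (Any.reverse⁺ (distinct-bounded-complete distinct bounded length≡n (toℕ<n c))))
      ... | r , e = r , toℕ-injective (sym e)
      avoids : AvoidsR τ213 F σ
      avoids = ¬occurrence213⇒avoids σ {F} (λ occ → avoids312 (subst Pattern312 columnsTB-σ (occurrence213⇒pattern312 σ occ)))

    open OnRows n (rowsTB F) (rowsTB-ascending F ferrers) (length-rowsTB F)

    δ213-inD2 : (R : RF τ213 F) → InD2 F (DFR (proj₁ R) , border F)
    δ213-inD2 (σ , R) with runningBorder-dyck-below (placement⇒admissible (σ , R))
    ... | dyck , below rewrite DFR≡runningBorder σ = dyck , refl , below

    δ213-bijective : Bijective (_≡_ on proj₁) (_≡_ on proj₁) (λ (R : RF τ213 F) → D2 F ∋ ((DFR (proj₁ R) , border F) , δ213-inD2 R))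
    δ213-bijective = (λ {R} {R′} → injective {R} {R′}) , surjective
      where
      injective : ∀ {R R′ : RF τ213 F} → (DFR (proj₁ R) , border F) ≡ (DFR (proj₁ R′) , border F) → proj₁ R ≡ proj₁ R′
      injective {R} {R′} e = columnsTB-injective (proj₁ R) (proj₁ R′)
        (runningBorder-injective (placement⇒admissible R) (placement⇒admissible R′)
          (trans (sym (DFR≡runningBorder (proj₁ R))) (trans (cong proj₁ e) (DFR≡runningBorder (proj₁ R′)))))
      surjective : ∀ (D : D2 F) → ∃ λ (R : RF τ213 F) → ∀ {R′ : RF τ213 F} → proj₁ R′ ≡ proj₁ R → (DFR (proj₁ R′) , border F) ≡ proj₁ D
      surjective ((D₀ , D₁) , dyck , refl , below)
        with runningBorder-surjective D₀ dyck below
      ... | T , adm , border-T with admissible⇒placement T adm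
      ...   | R , columns-R = R , λ { refl → cong (_, border F) (trans (DFR≡runningBorder (proj₁ R)) (trans (cong runningBorder columns-R) border-T)) }

module Words where

  open Lists
  open Borders
  open import Data.Nat
  open import Data.Nat.Properties
  open import Data.List using (List; []; _∷_; length)
  open import Data.Product using (_×_; _,_; proj₂)
  open import Data.Sum using (_⊎_; inj₁; inj₂)
  open import Data.Empty using (⊥)
  open import Relation.Binary.PropositionalEquality

  private
    variable
      i j : ℕ
      w : List Step

  #Sprefix : ℕ → List Step → ℕ
  #Sprefix zero    p       = 0
  #Sprefix (suc k) []      = 0
  #Sprefix (suc k) (E ∷ p) = #Sprefix k p
  #Sprefix (suc k) (S ∷ p) = suc (#Sprefix k p)

  E≢S : w [ i ]= E → w [ i ]= S → ⊥
  E≢S p q with []=-functional p q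
  ... | ()

  step-cases : ∀ w → i < length w → w [ i ]= E ⊎ w [ i ]= S
  step-cases {zero}  (E ∷ w) _ = inj₁ here
  step-cases {zero}  (S ∷ w) _ = inj₂ here
  step-cases {suc i} (s ∷ w) (s≤s i<) with step-cases w i<
  ... | inj₁ p = inj₁ (there p)
  ... | inj₂ p = inj₂ (there p)

  #Eprefix-mono : ∀ w → i ≤ j → #Eprefix i w ≤ #Eprefix j w
  #Eprefix-mono w       z≤n       = z≤n
  #Eprefix-mono []      (s≤s i≤j) = z≤n
  #Eprefix-mono (E ∷ w) (s≤s i≤j) = s≤s (#Eprefix-mono w i≤j)
  #Eprefix-mono (S ∷ w) (s≤s i≤j) = #Eprefix-mono w i≤j

  #Sprefix-mono : ∀ w → i ≤ j → #Sprefix i w ≤ #Sprefix j w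
  #Sprefix-mono w       z≤n       = z≤n
  #Sprefix-mono []      (s≤s i≤j) = z≤n
  #Sprefix-mono (E ∷ w) (s≤s i≤j) = #Sprefix-mono w i≤j
  #Sprefix-mono (S ∷ w) (s≤s i≤j) = s≤s (#Sprefix-mono w i≤j)

  #Eprefix-suc : w [ i ]= E → #Eprefix (suc i) w ≡ suc (#Eprefix i w)
  #Eprefix-suc {E ∷ w} here      = refl
  #Eprefix-suc {E ∷ w} (there p) = cong suc (#Eprefix-suc p)
  #Eprefix-suc {S ∷ w} (there p) = #Eprefix-suc p

  #Sprefix-suc : w [ i ]= S → #Sprefix (suc i) w ≡ suc (#Sprefix i w)
  #Sprefix-suc {S ∷ w} here      = refl
  #Sprefix-suc {E ∷ w} (there p) = #Sprefix-suc p
  #Sprefix-suc {S ∷ w} (there p) = cong suc (#Sprefix-suc p)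

  #Eprefix-< : w [ i ]= E → i < j → #Eprefix i w < #Eprefix j w
  #Eprefix-< {w} p i<j = subst (_≤ _) (#Eprefix-suc p) (#Eprefix-mono w i<j)

  #Sprefix-< : w [ i ]= S → i < j → #Sprefix i w < #Sprefix j w
  #Sprefix-< {w} p i<j = subst (_≤ _) (#Sprefix-suc p) (#Sprefix-mono w i<j)

  #Eprefix-<⁻ : ∀ w → #Eprefix i w < #Eprefix j w → i < j
  #Eprefix-<⁻ w lt = ≰⇒> (λ j≤i → <⇒≱ lt (#Eprefix-mono w j≤i))

  #Sprefix-<⁻ : ∀ w → #Sprefix i w < #Sprefix j w → i < j
  #Sprefix-<⁻ w lt = ≰⇒> (λ j≤i → <⇒≱ lt (#Sprefix-mono w j≤i))

  #Eprefix-length : ∀ w → #Eprefix (length w) w ≡ #E w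
  #Eprefix-length []      = refl
  #Eprefix-length (E ∷ w) = cong suc (#Eprefix-length w)
  #Eprefix-length (S ∷ w) = #Eprefix-length w

  #Sprefix-length : ∀ w → #Sprefix (length w) w ≡ #S w
  #Sprefix-length []      = refl
  #Sprefix-length (E ∷ w) = #Sprefix-length w
  #Sprefix-length (S ∷ w) = cong suc (#Sprefix-length w)

  #Eprefix<#E : w [ i ]= E → #Eprefix i w < #E w
  #Eprefix<#E {w} {i} p = subst (#Eprefix i w <_) (#Eprefix-length w) (#Eprefix-< p ([]=⇒<length p))

  #Sprefix<#S : w [ i ]= S → #Sprefix i w < #S w
  #Sprefix<#S {w} {i} p = subst (#Sprefix i w <_) (#Sprefix-length w) (#Sprefix-< p ([]=⇒<length p))

  length≡#E+#S : ∀ w → length w ≡ #E w + #S w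
  length≡#E+#S []      = refl
  length≡#E+#S (E ∷ w) = cong suc (length≡#E+#S w)
  length≡#E+#S (S ∷ w) = trans (cong suc (length≡#E+#S w)) (sym (+-suc (#E w) (#S w)))

  positionOfE : List Step → ℕ → ℕ
  positionOfE []      j       = 0
  positionOfE (E ∷ w) zero    = 0
  positionOfE (E ∷ w) (suc j) = suc (positionOfE w j)
  positionOfE (S ∷ w) j       = suc (positionOfE w j)

  positionOfS : List Step → ℕ → ℕ
  positionOfS []      j       = 0
  positionOfS (S ∷ w) zero    = 0
  positionOfS (S ∷ w) (suc j) = suc (positionOfS w j)
  positionOfS (E ∷ w) j       = suc (positionOfS w j)

  positionOfE-spec : ∀ w → j < #E w → w [ positionOfE w j ]= E × #Eprefix (positionOfE w j) w ≡ j
  positionOfE-spec {zero}  (E ∷ w) _       = here , refl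
  positionOfE-spec {suc j} (E ∷ w) (s≤s p) with positionOfE-spec w p
  ... | q , e = there q , cong suc e
  positionOfE-spec         (S ∷ w) p       with positionOfE-spec w p
  ... | q , e = there q , e

  positionOfS-spec : ∀ w → j < #S w → w [ positionOfS w j ]= S × #Sprefix (positionOfS w j) w ≡ j
  positionOfS-spec {zero}  (S ∷ w) _       = here , refl
  positionOfS-spec {suc j} (S ∷ w) (s≤s p) with positionOfS-spec w p
  ... | q , e = there q , cong suc e
  positionOfS-spec         (E ∷ w) p       with positionOfS-spec w p
  ... | q , e = there q , e

  positionOfE-#Eprefix : w [ i ]= E → positionOfE w (#Eprefix i w) ≡ i
  positionOfE-#Eprefix {E ∷ w} here      = refl
  positionOfE-#Eprefix {E ∷ w} (there p) = cong suc (positionOfE-#Eprefix p)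
  positionOfE-#Eprefix {S ∷ w} (there p) = cong suc (positionOfE-#Eprefix p)

  positionOfS-#Sprefix : w [ i ]= S → positionOfS w (#Sprefix i w) ≡ i
  positionOfS-#Sprefix {S ∷ w} here      = refl
  positionOfS-#Sprefix {E ∷ w} (there p) = cong suc (positionOfS-#Sprefix p)
  positionOfS-#Sprefix {S ∷ w} (there p) = cong suc (positionOfS-#Sprefix p)

  borderTB-south-abscissa : ∀ {a ts p k t} → Ascending a ts → borderTB a ts [ p ]= S →
                            #Sprefix p (borderTB a ts) ≡ k → ts [ k ]= t → a + #Eprefix p (borderTB a ts) ≡ t
  borderTB-south-abscissa {a} {ts} as q sk tk with nextStep ts as
  borderTB-south-abscissa {a} {[]} _ () _ _ | stop
  borderTB-south-abscissa {a} {l ∷ ls} {p} as q sk tk | east a<l rewrite borderTB-E ls a<l with p | q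
  ... | suc p′ | there q′ =
    trans (+-suc a _) (borderTB-south-abscissa {ts = l ∷ ls} (a<l , proj₂ as) q′ sk tk)
  borderTB-south-abscissa {a} {a ∷ ls} {p} as q sk tk | south rewrite borderTB-S a ls with p | q | sk | tk
  ... | zero   | here     | refl | here     = +-identityʳ a
  ... | suc p′ | there q′ | refl | there tk′ = borderTB-south-abscissa (proj₂ as) q′ refl tk′

module PartnerFunctions where

  open Lists
  open Borders
  open RunningMaxima
  open Core
  open Words
  open import Data.Nat
  open import Data.Nat.Properties
  open import Data.List using (List; length; applyUpTo)
  open import Data.List.Membership.Propositional using (_∈_)
  open import Data.List.Relation.Binary.Pointwise using (Pointwise)
  open import Data.Product using (∃; _×_; _,_; proj₁; proj₂)
  open import Data.Sum using (inj₁; inj₂)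
  import Data.Sum as Sum
  open import Data.Empty using (⊥-elim)
  open import Relation.Binary.PropositionalEquality

  record Pattern213 (N : ℕ) (g : ℕ → ℕ) : Set where
    constructor pattern213
    field
      i₁ i₂ i₃ i₄ i₅ i₆ : ℕ
      i₁<i₂ : i₁ < i₂
      i₂<i₃ : i₂ < i₃
      i₃<i₄ : i₃ < i₄
      i₄<i₅ : i₄ < i₅
      i₅<i₆ : i₅ < i₆
      i₆<N  : i₆ < N
      g-i₁  : g i₁ ≡ i₅
      g-i₂  : g i₂ ≡ i₆
      g-i₃  : g i₃ ≡ i₄

  record IsMatching (w : List Step) (g : ℕ → ℕ) : Set where
    field
      partner-<  : ∀ {i} → i < length w → g i < length w
      involutive : ∀ {i} → i < length w → g (g i) ≡ i
      opens      : ∀ {i} → w [ i ]= E → i < g i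
      closes     : ∀ {i} → w [ i ]= S → g i < i

    partner-closes : ∀ {i} → w [ i ]= E → w [ g i ]= S
    partner-closes {i} p with step-cases w (partner-< ([]=⇒<length p))
    ... | inj₂ q = q
    ... | inj₁ q = ⊥-elim (<-asym (opens p) (subst (g i <_) (involutive ([]=⇒<length p)) (opens q)))

    partner-opens : ∀ {i} → w [ i ]= S → w [ g i ]= E
    partner-opens {i} p with step-cases w (partner-< ([]=⇒<length p))
    ... | inj₁ q = q
    ... | inj₂ q = ⊥-elim (<-asym (closes p) (subst (_< g i) (involutive ([]=⇒<length p)) (closes q)))

    <partner⇒opens : ∀ {i} → i < length w → i < g i → w [ i ]= E
    <partner⇒opens {i} i< i<g with step-cases w i<
    ... | inj₁ p = p
    ... | inj₂ p = ⊥-elim (<-asym i<g (closes p))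

  -- entry k: the column of the opener matched with the closer of row k (rows from the top)
  closerColumns : List Step → ℕ → (ℕ → ℕ) → List ℕ
  closerColumns w n g = applyUpTo (λ k → #Eprefix (g (positionOfS w k)) w) n

  module _ {w : List Step} {n : ℕ} (#S≡n : #S w ≡ n) (g : ℕ → ℕ) where

    closerColumns-[]= : ∀ {c} → w [ c ]= S → closerColumns w n g [ #Sprefix c w ]= #Eprefix (g c) w
    closerColumns-[]= {c} p =
      subst (λ x → closerColumns w n g [ #Sprefix c w ]= #Eprefix (g x) w) (positionOfS-#Sprefix p)
        (applyUpTo-[]= _ (subst (_ <_) #S≡n (#Sprefix<#S p)))

    closerColumns-[]=⁻ : ∀ {k v} → closerColumns w n g [ k ]= v →
                         ∃ λ c → w [ c ]= S × #Sprefix c w ≡ k × v ≡ #Eprefix (g c) w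
    closerColumns-[]=⁻ q with applyUpTo-[]=⁻ _ q
    ... | k<n , refl with positionOfS-spec w (subst (_ <_) (sym #S≡n) k<n)
    ...   | p , e = _ , p , e , refl

  module OnBorder (n : ℕ) (ts : List ℕ) (ts-ascending : Ascending 0 ts) (length-ts : length ts ≡ n)
           (#E≡n : #E (borderTB 0 ts) ≡ n) where

    private
      w : List Step
      w = borderTB 0 ts
      #S≡n : #S w ≡ n
      #S≡n = trans (#S-borderTB 0 ts) length-ts

    column-of-closer : ∀ {c k t} → w [ c ]= S → #Sprefix c w ≡ k → ts [ k ]= t → #Eprefix c w ≡ t
    column-of-closer = borderTB-south-abscissa ts-ascending

    module _ {g : ℕ → ℕ} (matching : IsMatching w g) where
      open IsMatching matching

      closer-determined : ∀ {c c′} → w [ c ]= S → w [ c′ ]= S → #Eprefix (g c) w ≡ #Eprefix (g c′) w → c ≡ c′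
      closer-determined {c} {c′} p p′ e = begin
        c                                   ≡⟨ involutive ([]=⇒<length p) ⟨
        g (g c)                             ≡⟨ cong g (positionOfE-#Eprefix (partner-opens p)) ⟨
        g (positionOfE w (#Eprefix (g c) w))  ≡⟨ cong (λ x → g (positionOfE w x)) e ⟩
        g (positionOfE w (#Eprefix (g c′) w)) ≡⟨ cong g (positionOfE-#Eprefix (partner-opens p′)) ⟩
        g (g c′)                            ≡⟨ involutive ([]=⇒<length p′) ⟩
        c′                                  ∎
        where open ≡-Reasoning

      closerColumns-distinct : Distinct (closerColumns w n g)
      closerColumns-distinct = distinct-applyUpTo _ n injective
        where
        injective : ∀ {k k′} → k < n → k′ < n →
                    #Eprefix (g (positionOfS w k)) w ≡ #Eprefix (g (positionOfS w k′)) w → k ≡ k′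
        injective k<n k′<n e
          with positionOfS-spec w (subst (_ <_) (sym #S≡n) k<n) | positionOfS-spec w (subst (_ <_) (sym #S≡n) k′<n)
        ... | p , e₁ | p′ , e₂ = trans (sym e₁) (trans (cong (λ c → #Sprefix c w) (closer-determined p p′ e)) e₂)

      closerColumns-bounded : ∀ {x} → x ∈ closerColumns w n g → x < n
      closerColumns-bounded x∈ with ∈⇒[]= x∈
      ... | _ , q with closerColumns-[]=⁻ #S≡n g q
      ...   | c , p , _ , refl = subst (_ <_) #E≡n (#Eprefix<#E (partner-opens p))

      closerColumns-inBoard : Pointwise _<_ (closerColumns w n g) ts
      closerColumns-inBoard = subst (λ m → Pointwise _<_ (closerColumns w m g) ts) length-ts
        (applyUpTo-pointwise _ ts below)
        where
        below : ∀ {k t} → ts [ k ]= t → #Eprefix (g (positionOfS w k)) w < t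
        below {k} t∈ with positionOfS-spec w (subst (k <_) (sym (#S-borderTB 0 ts)) ([]=⇒<length t∈))
        ... | p , e = subst (_ <_) (column-of-closer p e t∈) (#Eprefix-< (partner-opens p) (closes p))

      closerColumns-opener : ∀ {o} → w [ o ]= E → closerColumns w n g [ #Sprefix (g o) w ]= #Eprefix o w
      closerColumns-opener {o} p =
        subst (λ x → closerColumns w n g [ #Sprefix (g o) w ]= #Eprefix x w) (involutive ([]=⇒<length p))
          (closerColumns-[]= #S≡n g (partner-closes p))

      pattern312At⇒pattern213 : Pattern312At (closerColumns w n g) → Pattern213 (length w) g
      pattern312At⇒pattern213 (pattern312At _ _ _ _ _ _ k₁<k₂ k₂<k₃ T[k₁] T[k₂] T[k₃] y<z z<x)
        with closerColumns-[]=⁻ #S≡n g T[k₁] | closerColumns-[]=⁻ #S≡n g T[k₂] | closerColumns-[]=⁻ #S≡n g T[k₃]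
      ... | c₁ , p₁ , refl , refl | c₂ , p₂ , refl , refl | c₃ , p₃ , refl , refl =
        pattern213 (g c₂) (g c₃) (g c₁) c₁ c₂ c₃
          (#Eprefix-<⁻ w y<z) (#Eprefix-<⁻ w z<x) (closes p₁) (#Sprefix-<⁻ w k₁<k₂) (#Sprefix-<⁻ w k₂<k₃)
          ([]=⇒<length p₃) (involutive ([]=⇒<length p₂)) (involutive ([]=⇒<length p₃)) (involutive ([]=⇒<length p₁))

      pattern213⇒pattern312At : Pattern213 (length w) g → Pattern312At (closerColumns w n g)
      pattern213⇒pattern312At (pattern213 i₁ i₂ i₃ i₄ i₅ i₆ i₁<i₂ i₂<i₃ i₃<i₄ i₄<i₅ i₅<i₆ i₆<N g-i₁ g-i₂ g-i₃) =
        pattern312At _ _ _ _ _ _ (#Sprefix-< closer₄ i₄<i₅) (#Sprefix-< closer₅ i₅<i₆)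
          (subst (λ c → closerColumns w n g [ #Sprefix c w ]= _) g-i₃ (closerColumns-opener opener₃))
          (subst (λ c → closerColumns w n g [ #Sprefix c w ]= _) g-i₁ (closerColumns-opener opener₁))
          (subst (λ c → closerColumns w n g [ #Sprefix c w ]= _) g-i₂ (closerColumns-opener opener₂))
          (#Eprefix-< opener₁ i₁<i₂) (#Eprefix-< opener₂ i₂<i₃)
        where
        i₅<N = <-trans i₅<i₆ i₆<N
        i₄<N = <-trans i₄<i₅ i₅<N
        i₃<N = <-trans i₃<i₄ i₄<N
        i₂<N = <-trans i₂<i₃ i₃<N
        i₁<N = <-trans i₁<i₂ i₂<N
        opener₁ = <partner⇒opens i₁<N (subst (i₁ <_) (sym g-i₁) (<-trans i₁<i₂ (<-trans i₂<i₃ (<-trans i₃<i₄ i₄<i₅))))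
        opener₂ = <partner⇒opens i₂<N (subst (i₂ <_) (sym g-i₂) (<-trans i₂<i₃ (<-trans i₃<i₄ (<-trans i₄<i₅ i₅<i₆))))
        opener₃ = <partner⇒opens i₃<N (subst (i₃ <_) (sym g-i₃) i₃<i₄)
        closer₄ = subst (λ c → w [ c ]= S) g-i₃ (partner-closes opener₃)
        closer₅ = subst (λ c → w [ c ]= S) g-i₁ (partner-closes opener₁)

    same-partner-at-closer : ∀ {g g′} → IsMatching w g → IsMatching w g′ → closerColumns w n g ≡ closerColumns w n g′ →
                             ∀ {c} → w [ c ]= S → g c ≡ g′ c
    same-partner-at-closer {g} {g′} m m′ e {c} p = begin
      g c                                   ≡⟨ positionOfE-#Eprefix (IsMatching.partner-opens m p) ⟨
      positionOfE w (#Eprefix (g c) w)      ≡⟨ cong (positionOfE w) same-column ⟩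
      positionOfE w (#Eprefix (g′ c) w)     ≡⟨ positionOfE-#Eprefix (IsMatching.partner-opens m′ p) ⟩
      g′ c                                  ∎
      where
      open ≡-Reasoning
      same-column : #Eprefix (g c) w ≡ #Eprefix (g′ c) w
      same-column = []=-functional (subst (_[ #Sprefix c w ]= _) e (closerColumns-[]= #S≡n g p)) (closerColumns-[]= #S≡n g′ p)

    closerColumns-injective : ∀ {g g′} → IsMatching w g → IsMatching w g′ → closerColumns w n g ≡ closerColumns w n g′ →
                              ∀ {i} → i < length w → g i ≡ g′ i
    closerColumns-injective {g} {g′} m m′ e {i} i< with step-cases w i<
    ... | inj₂ p = same-partner-at-closer m m′ e p
    ... | inj₁ p = begin
      g i              ≡⟨ IsMatching.involutive m′ (IsMatching.partner-< m i<) ⟨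
      g′ (g′ (g i))    ≡⟨ cong g′ (same-partner-at-closer m m′ e (IsMatching.partner-closes m p)) ⟨
      g′ (g (g i))     ≡⟨ cong g′ (IsMatching.involutive m i<) ⟩
      g′ i             ∎
      where open ≡-Reasoning

    module FromColumns {T : List ℕ} (admissible : Admissible n ts T) where
      open Admissible admissible

      partnerFor : Step → ℕ → ℕ
      partnerFor E i = positionOfS w (indexOf T (#Eprefix i w))
      partnerFor S i = positionOfE w (lookupOr 0 T (#Sprefix i w))

      partner : ℕ → ℕ
      partner i = partnerFor (lookupOr E w i) i

      opener-partner : ∀ {o} → w [ o ]= E → let k = indexOf T (#Eprefix o w) in
                       T [ k ]= #Eprefix o w × w [ partner o ]= S × #Sprefix (partner o) w ≡ k × o < partner o
      opener-partner {o} p rewrite []=⇒lookupOr E p =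
        T[k]=j , closer , #S-closer , #Eprefix-<⁻ w (subst (_ <_) (sym (column-of-closer closer #S-closer ts[k])) j<ts[k])
        where
        j = #Eprefix o w
        k = indexOf T j
        T[k]=j : T [ k ]= j
        T[k]=j = indexOf-[]= T (distinct-bounded-complete distinct bounded length≡n (subst (j <_) #E≡n (#Eprefix<#E p)))
        k<n : k < n
        k<n = subst (k <_) length≡n ([]=⇒<length T[k]=j)
        closer = proj₁ (positionOfS-spec w (subst (k <_) (sym #S≡n) k<n))
        #S-closer = proj₂ (positionOfS-spec w (subst (k <_) (sym #S≡n) k<n))
        ts[k] : ts [ k ]= lookupOr 0 ts k
        ts[k] = lookupOr-[]= 0 ts (subst (k <_) (sym length-ts) k<n)
        j<ts[k] : j < lookupOr 0 ts k
        j<ts[k] = Pointwise-[]= inBoard T[k]=j ts[k]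

      closer-partner : ∀ {c} → w [ c ]= S → let v = lookupOr 0 T (#Sprefix c w) in
                       T [ #Sprefix c w ]= v × w [ partner c ]= E × #Eprefix (partner c) w ≡ v × partner c < c
      closer-partner {c} p rewrite []=⇒lookupOr E p =
        T[k]=v , opener , #E-opener , #Eprefix-<⁻ w (subst₂ _<_ (sym #E-opener) (sym (column-of-closer p refl ts[k])) v<ts[k])
        where
        k = #Sprefix c w
        v = lookupOr 0 T k
        k<n : k < n
        k<n = subst (k <_) #S≡n (#Sprefix<#S p)
        T[k]=v : T [ k ]= v
        T[k]=v = lookupOr-[]= 0 T (subst (k <_) (sym length≡n) k<n)
        opener = proj₁ (positionOfE-spec w (subst (v <_) (sym #E≡n) (bounded ([]=⇒∈ T[k]=v))))
        #E-opener = proj₂ (positionOfE-spec w (subst (v <_) (sym #E≡n) (bounded ([]=⇒∈ T[k]=v))))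
        ts[k] : ts [ k ]= lookupOr 0 ts k
        ts[k] = lookupOr-[]= 0 ts (subst (k <_) (sym length-ts) k<n)
        v<ts[k] : v < lookupOr 0 ts k
        v<ts[k] = Pointwise-[]= inBoard T[k]=v ts[k]

      partner-at-E : ∀ {i} → w [ i ]= E → partner i ≡ positionOfS w (indexOf T (#Eprefix i w))
      partner-at-E p rewrite []=⇒lookupOr E p = refl

      partner-at-S : ∀ {i} → w [ i ]= S → partner i ≡ positionOfE w (lookupOr 0 T (#Sprefix i w))
      partner-at-S p rewrite []=⇒lookupOr E p = refl

      partner-isMatching : IsMatching w partner
      partner-isMatching = record
        { partner-<  = λ i< → Sum.[ (λ p → []=⇒<length (proj₁ (proj₂ (opener-partner p))))
                                  , (λ p → []=⇒<length (proj₁ (proj₂ (closer-partner p)))) ] (step-cases w i<)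
        ; involutive = λ i< → Sum.[ involutive-E , involutive-S ] (step-cases w i<)
        ; opens      = λ p → proj₂ (proj₂ (proj₂ (opener-partner p)))
        ; closes     = λ p → proj₂ (proj₂ (proj₂ (closer-partner p))) }
        where
        open ≡-Reasoning
        involutive-E : ∀ {o} → w [ o ]= E → partner (partner o) ≡ o
        involutive-E {o} p with opener-partner p
        ... | T[k]=j , closer , #S-closer , _ = begin
          partner (partner o)                                     ≡⟨ partner-at-S closer ⟩
          positionOfE w (lookupOr 0 T (#Sprefix (partner o) w))   ≡⟨ cong (λ k → positionOfE w (lookupOr 0 T k)) #S-closer ⟩
          positionOfE w (lookupOr 0 T (indexOf T (#Eprefix o w))) ≡⟨ cong (positionOfE w) ([]=⇒lookupOr 0 T[k]=j) ⟩
          positionOfE w (#Eprefix o w)                            ≡⟨ positionOfE-#Eprefix p ⟩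
          o                                                       ∎
        involutive-S : ∀ {c} → w [ c ]= S → partner (partner c) ≡ c
        involutive-S {c} p with closer-partner p
        ... | T[k]=v , opener , #E-opener , _ = begin
          partner (partner c)                                   ≡⟨ partner-at-E opener ⟩
          positionOfS w (indexOf T (#Eprefix (partner c) w))    ≡⟨ cong (λ v → positionOfS w (indexOf T v)) #E-opener ⟩
          positionOfS w (indexOf T (lookupOr 0 T (#Sprefix c w))) ≡⟨ cong (positionOfS w) index-v ⟩
          positionOfS w (#Sprefix c w)                          ≡⟨ positionOfS-#Sprefix p ⟩
          c                                                     ∎
          where
          index-v = distinct-[]=-injective distinct (indexOf-[]= T ([]=⇒∈ T[k]=v)) T[k]=v

      closerColumns-partner : closerColumns w n partner ≡ T
      closerColumns-partner = applyUpTo-unique _ n length≡n entry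
        where
        entry : ∀ {k} → k < n → T [ k ]= #Eprefix (partner (positionOfS w k)) w
        entry k<n with positionOfS-spec w (subst (_ <_) (sym #S≡n) k<n)
        ... | closer , #S-closer with closer-partner closer
        ...   | T[k]=v , _ , #E-opener , _ = subst₂ (T [_]=_) #S-closer (sym #E-opener) T[k]=v

module PerfectMatchings (n : ℕ) where

  open Lists
  open Borders
  open RunningMaxima
  open Core
  open Columns
  open Words
  open PartnerFunctions
  open import Data.Nat
  open import Data.Nat.Properties
  open import Data.Fin as Fin using (Fin; toℕ; fromℕ<; zero; suc; _↑ˡ_; _↑ʳ_; opposite)
  open import Data.Fin.Properties using (toℕ-injective; toℕ<n; toℕ-fromℕ<)
  open import Data.Vec using (lookup; tabulate)
  open import Data.Vec.Properties using (lookup∘tabulate; length-toList)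
  open import Data.List using (List; length)
  open import Data.Product using (∃; _×_; _,_)
  open import Data.Sum using (_⊎_; inj₁; inj₂)
  open import Data.Empty using (⊥-elim)
  open import Relation.Nullary using (¬_; yes; no)
  open import Relation.Binary.PropositionalEquality

  stepOf-spec : ∀ {m} (i j : Fin m) → (toℕ i < toℕ j × stepOf i j ≡ E) ⊎ (¬ toℕ i < toℕ j × stepOf i j ≡ S)
  stepOf-spec i j with toℕ i <? toℕ j
  ... | yes i<j = inj₁ (i<j , refl)
  ... | no  i≮j = inj₂ (i≮j , refl)

  partnerOf : Matching n → ℕ → ℕ
  partnerOf M = lookupOr 0 (columns M)

  partnerOf-toℕ : (M : Matching n) (i : Fin (n + n)) → partnerOf M (toℕ i) ≡ toℕ (lookup M i)
  partnerOf-toℕ M i = []=⇒lookupOr 0 (columns-[]= M i)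

  shape-[]= : (M : Matching n) (i : Fin (n + n)) → shape {n} M [ toℕ i ]= stepOf i (lookup M i)
  shape-[]= M i = subst (shape {n} M [ toℕ i ]=_) (lookup∘tabulate _ i) (toList-[]= (tabulate (λ j → stepOf j (lookup M j))) i)

  length-shape : (M : Matching n) → length (shape {n} M) ≡ n + n
  length-shape M = length-toList (tabulate (λ j → stepOf j (lookup M j)))

  fin : ∀ {i} → i < n + n → ∃ λ (fi : Fin (n + n)) → toℕ fi ≡ i
  fin i< = fromℕ< i< , toℕ-fromℕ< i<

  module WithShape (w : List Step) (length-w : length w ≡ n + n) where

    isMatching-partnerOf : ∀ (M : Matching n) → IsPerfectMatching {n} M → shape {n} M ≡ w → IsMatching w (partnerOf M)
    isMatching-partnerOf M (involution , no-fixpoint) refl = record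
      { partner-<  = λ i< → with-fin i< partner-<
      ; involutive = λ i< → with-fin i< involutive
      ; opens      = λ p → with-fin {P = λ i → shape {n} M [ i ]= E → i < partnerOf M i} ([]=⇒<length p) opens p
      ; closes     = λ p → with-fin {P = λ i → shape {n} M [ i ]= S → partnerOf M i < i} ([]=⇒<length p) closes p }
      where
      open ≡-Reasoning
      with-fin : ∀ {i} {P : ℕ → Set} → i < length (shape {n} M) → (∀ fi → P (toℕ fi)) → P i
      with-fin i< k with fin (subst (_ <_) length-w i<)
      ... | fi , refl = k fi
      partner-< : ∀ fi → partnerOf M (toℕ fi) < length (shape {n} M)
      partner-< fi = subst₂ _<_ (sym (partnerOf-toℕ M fi)) (sym length-w) (toℕ<n (lookup M fi))
      involutive : ∀ fi → partnerOf M (partnerOf M (toℕ fi)) ≡ toℕ fi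
      involutive fi = begin
        partnerOf M (partnerOf M (toℕ fi))  ≡⟨ cong (partnerOf M) (partnerOf-toℕ M fi) ⟩
        partnerOf M (toℕ (lookup M fi))     ≡⟨ partnerOf-toℕ M (lookup M fi) ⟩
        toℕ (lookup M (lookup M fi))        ≡⟨ cong toℕ (involution fi) ⟩
        toℕ fi                              ∎
      opens : ∀ fi → shape {n} M [ toℕ fi ]= E → toℕ fi < partnerOf M (toℕ fi)
      opens fi p with stepOf-spec fi (lookup M fi)
      ... | inj₁ (lt , _) = subst (_ <_) (sym (partnerOf-toℕ M fi)) lt
      ... | inj₂ (_ , e)  = ⊥-elim (E≢S p (subst (shape {n} M [ toℕ fi ]=_) e (shape-[]= M fi)))
      closes : ∀ fi → shape {n} M [ toℕ fi ]= S → partnerOf M (toℕ fi) < toℕ fi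
      closes fi p with stepOf-spec fi (lookup M fi)
      ... | inj₂ (≮ , _) = subst (_< _) (sym (partnerOf-toℕ M fi))
                             (≤∧≢⇒< (≮⇒≥ ≮) (λ e → no-fixpoint fi (toℕ-injective e)))
      ... | inj₁ (_ , e) = ⊥-elim (E≢S (subst (shape {n} M [ toℕ fi ]=_) e (shape-[]= M fi)) p)

    module _ {g : ℕ → ℕ} (matching : IsMatching w g) where
      open IsMatching matching

      private
        i<w : ∀ (i : Fin (n + n)) → toℕ i < length w
        i<w i = subst (toℕ i <_) (sym length-w) (toℕ<n i)
        g-bound : ∀ (i : Fin (n + n)) → g (toℕ i) < n + n
        g-bound i = subst (g (toℕ i) <_) length-w (partner-< (i<w i))

      toMatching : Matching n
      toMatching = tabulate (λ i → fromℕ< (g-bound i))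

      toMatching-toℕ : ∀ i → toℕ (lookup toMatching i) ≡ g (toℕ i)
      toMatching-toℕ i = trans (cong toℕ (lookup∘tabulate _ i)) (toℕ-fromℕ< (g-bound i))

      partnerOf-toMatching : ∀ {i} → i < length w → partnerOf toMatching i ≡ g i
      partnerOf-toMatching i< with fin (subst (_ <_) length-w i<)
      ... | fi , refl = trans (partnerOf-toℕ toMatching fi) (toMatching-toℕ fi)

      toMatching-perfect : IsPerfectMatching {n} toMatching
      toMatching-perfect = involution , no-fixpoint
        where
        involution : ∀ i → lookup toMatching (lookup toMatching i) ≡ i
        involution i = toℕ-injective (begin
          toℕ (lookup toMatching (lookup toMatching i)) ≡⟨ toMatching-toℕ (lookup toMatching i) ⟩
          g (toℕ (lookup toMatching i))                 ≡⟨ cong g (toMatching-toℕ i) ⟩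
          g (g (toℕ i))                                 ≡⟨ involutive (i<w i) ⟩
          toℕ i                                         ∎)
          where open ≡-Reasoning
        no-fixpoint : ∀ i → lookup toMatching i ≢ i
        no-fixpoint i e with step-cases w (i<w i)
        ... | inj₁ p = <-irrefl (trans (sym (cong toℕ e)) (toMatching-toℕ i)) (opens p)
        ... | inj₂ p = <-irrefl (trans (sym (toMatching-toℕ i)) (cong toℕ e)) (closes p)

      shape-toMatching : shape {n} toMatching ≡ w
      shape-toMatching = []=-extensional (trans (length-shape toMatching) (sym length-w)) same-steps
        where
        same-steps : ∀ {i s} → shape {n} toMatching [ i ]= s → w [ i ]= s
        same-steps p with fin (subst (_ <_) (length-shape toMatching) ([]=⇒<length p))
        ... | fi , refl with []=-functional p (shape-[]= toMatching fi) | stepOf-spec fi (lookup toMatching fi)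
        ...   | refl | inj₁ (lt , e) rewrite e = <partner⇒opens (i<w fi) (subst (_ <_) (toMatching-toℕ fi) lt)
        ...   | refl | inj₂ (≮ , e) rewrite e with step-cases w (i<w fi)
        ...     | inj₂ q = q
        ...     | inj₁ q = ⊥-elim (≮ (subst (_ <_) (sym (toMatching-toℕ fi)) (opens q)))

    containsM⇒pattern213 : ∀ (M : Matching n) → ContainsM {n} τ213 M → Pattern213 (length w) (partnerOf M)
    containsM⇒pattern213 M (f , increasing , pairs) =
      pattern213 _ _ _ _ _ _ (increasing f₀ f₁ ≤-refl) (increasing f₁ f₂ ≤-refl) (increasing f₂ f₃ ≤-refl)
        (increasing f₃ f₄ ≤-refl) (increasing f₄ f₅ ≤-refl) (subst (toℕ (f f₅) <_) (sym length-w) (toℕ<n (f f₅)))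
        (pair f₀ f₄ (pairs zero)) (pair f₁ f₅ (pairs (suc zero))) (pair f₂ f₃ (pairs (suc (suc zero))))
      where
      f₀ f₁ f₂ f₃ f₄ f₅ : Fin 6
      f₀ = zero
      f₁ = suc zero
      f₂ = suc (suc zero)
      f₃ = suc (suc (suc zero))
      f₄ = suc (suc (suc (suc zero)))
      f₅ = suc (suc (suc (suc (suc zero))))
      pair : ∀ a b → lookup M (f a) ≡ f b → partnerOf M (toℕ (f a)) ≡ toℕ (f b)
      pair a b e = trans (partnerOf-toℕ M (f a)) (cong toℕ e)

    pattern213⇒containsM : ∀ (M : Matching n) → Pattern213 (length w) (partnerOf M) → ContainsM {n} τ213 M
    pattern213⇒containsM M (pattern213 i₁ i₂ i₃ i₄ i₅ i₆ i₁<i₂ i₂<i₃ i₃<i₄ i₄<i₅ i₅<i₆ i₆<N g-i₁ g-i₂ g-i₃) =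
      f , increasing , pairs
      where
      h : ℕ → ℕ
      h 0 = i₁
      h 1 = i₂
      h 2 = i₃
      h 3 = i₄
      h 4 = i₅
      h _ = i₆
      step : ∀ {j} → suc j ≤ 5 → h j < h (suc j)
      step {0} _ = i₁<i₂
      step {1} _ = i₂<i₃
      step {2} _ = i₃<i₄
      step {3} _ = i₄<i₅
      step {4} _ = i₅<i₆
      step {suc (suc (suc (suc (suc _))))} (s≤s (s≤s (s≤s (s≤s (s≤s ())))))
      h-increasing : ∀ {i j} → i < j → j ≤ 5 → h i < h j
      h-increasing {i} {suc j} i<1+j j≤5 with m<1+n⇒m<n∨m≡n i<1+j
      ... | inj₁ i<j  = <-trans (h-increasing i<j (<⇒≤ j≤5)) (step j≤5)
      ... | inj₂ refl = step j≤5
      h<N : ∀ j → j ≤ 5 → h j < n + n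
      h<N j j≤5 with m≤n⇒m<n∨m≡n j≤5
      ... | inj₁ j<5  = subst (h j <_) length-w (<-trans (h-increasing j<5 ≤-refl) i₆<N)
      ... | inj₂ refl = subst (i₆ <_) length-w i₆<N
      f : Fin 6 → Fin (n + n)
      f a = fromℕ< (h<N (toℕ a) (s≤s⁻¹ (toℕ<n a)))
      toℕ-f : ∀ a → toℕ (f a) ≡ h (toℕ a)
      toℕ-f a = toℕ-fromℕ< (h<N (toℕ a) (s≤s⁻¹ (toℕ<n a)))
      increasing : ∀ (a b : Fin 6) → toℕ a < toℕ b → toℕ (f a) < toℕ (f b)
      increasing a b a<b = subst₂ _<_ (sym (toℕ-f a)) (sym (toℕ-f b)) (h-increasing a<b (s≤s⁻¹ (toℕ<n b)))
      pair : ∀ a b → partnerOf M (h (toℕ a)) ≡ h (toℕ b) → lookup M (f a) ≡ f b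
      pair a b e = toℕ-injective (begin
        toℕ (lookup M (f a))     ≡⟨ partnerOf-toℕ M (f a) ⟨
        partnerOf M (toℕ (f a))  ≡⟨ cong (partnerOf M) (toℕ-f a) ⟩
        partnerOf M (h (toℕ a))  ≡⟨ e ⟩
        h (toℕ b)                ≡⟨ toℕ-f b ⟨
        toℕ (f b)                ∎)
        where open ≡-Reasoning
      pairs : ∀ (a : Fin 3) → lookup M (f (a ↑ˡ 3)) ≡ f (3 ↑ʳ opposite (lookup τ213 a))
      pairs zero             = pair zero (suc (suc (suc (suc zero)))) g-i₁
      pairs (suc zero)       = pair (suc zero) (suc (suc (suc (suc (suc zero))))) g-i₂
      pairs (suc (suc zero)) = pair (suc (suc zero)) (suc (suc (suc zero))) g-i₃

module MatchingBijection (n : ℕ) (F : Board n) (hF : InFerrersDyck n F) where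

  open Lists
  open Borders
  open RunningMaxima
  open Core
  open Words
  open PartnerFunctions
  open PerfectMatchings n
  open RookPlacements using (rowsTB; rowsTB-ascending; length-rowsTB)
  open import Data.Nat
  open import Data.Nat.Properties
  open import Data.Fin using (toℕ)
  open import Data.Fin.Properties using (toℕ<n; toℕ-injective)
  open import Data.Vec using (lookup; tabulate)
  open import Data.Vec.Properties using (tabulate∘lookup; tabulate-cong)
  open import Data.List using (List; length)
  open import Data.List.Properties using (length-applyUpTo)
  open import Data.Product using (∃; _×_; _,_; proj₁; proj₂)
  open import Relation.Binary.PropositionalEquality

  private
    ts = rowsTB F
    w  = border F
    ts-ascending = rowsTB-ascending F (proj₁ hF)
    ts-length    = length-rowsTB F
    #E≡n : #E w ≡ n
    #E≡n = proj₂ (proj₂ hF)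
    length-w : length w ≡ n + n
    length-w = trans (length≡#E+#S w) (cong₂ _+_ #E≡n (trans (#S-borderTB 0 ts) ts-length))

  open OnRows n ts ts-ascending ts-length
  open WithShape w length-w
  open OnBorder n ts ts-ascending ts-length #E≡n

  columnsOf : Matching n → List ℕ
  columnsOf M = closerColumns w n (partnerOf M)

  isMatching : (M : MF τ213 F) → IsMatching w (partnerOf (proj₁ M))
  isMatching (M , perfect , shape-M , _) = isMatching-partnerOf M perfect shape-M

  matching⇒admissible : (M : MF τ213 F) → Admissible n ts (columnsOf (proj₁ M))
  matching⇒admissible M@(M′ , _ , _ , avoids) = record
    { distinct  = closerColumns-distinct (isMatching M)
    ; bounded   = closerColumns-bounded (isMatching M)
    ; length≡n  = length-applyUpTo _ n
    ; inBoard   = closerColumns-inBoard (isMatching M)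
    ; avoids312 = λ p → avoids (pattern213⇒containsM M′
                          (pattern312At⇒pattern213 (isMatching M) (pattern312⇒pattern312At p))) }

  δ : MF τ213 F → D2 F
  δ M = (runningBorder (columnsOf (proj₁ M)) , border F) , proj₁ dyck-below , refl , proj₂ dyck-below
    where dyck-below = runningBorder-dyck-below (matching⇒admissible M)

  δ-injective : ∀ {M M′ : MF τ213 F} → proj₁ (δ M) ≡ proj₁ (δ M′) → proj₁ M ≡ proj₁ M′
  δ-injective {M} {M′} e = begin
    proj₁ M                                                ≡⟨ tabulate∘lookup (proj₁ M) ⟨
    tabulate (lookup (proj₁ M))                            ≡⟨ tabulate-cong same-partner ⟩
    tabulate (lookup (proj₁ M′))                           ≡⟨ tabulate∘lookup (proj₁ M′) ⟩
    proj₁ M′                                               ∎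
    where
    open ≡-Reasoning
    same-columns : columnsOf (proj₁ M) ≡ columnsOf (proj₁ M′)
    same-columns = runningBorder-injective (matching⇒admissible M) (matching⇒admissible M′)
                     (cong proj₁ e)
    same-partner : ∀ i → lookup (proj₁ M) i ≡ lookup (proj₁ M′) i
    same-partner i = toℕ-injective (begin
      toℕ (lookup (proj₁ M) i)       ≡⟨ partnerOf-toℕ (proj₁ M) i ⟨
      partnerOf (proj₁ M) (toℕ i)    ≡⟨ closerColumns-injective (isMatching M) (isMatching M′)
                                          same-columns (subst (toℕ i <_) (sym length-w) (toℕ<n i)) ⟩
      partnerOf (proj₁ M′) (toℕ i)   ≡⟨ partnerOf-toℕ (proj₁ M′) i ⟩
      toℕ (lookup (proj₁ M′) i)      ∎)

  δ-surjective : ∀ (D : D2 F) → ∃ λ (M : MF τ213 F) → ∀ {M′ : MF τ213 F} → proj₁ M′ ≡ proj₁ M → proj₁ (δ M′) ≡ proj₁ D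
  δ-surjective ((D₀ , D₁) , dyck , refl , below)
    with runningBorder-surjective D₀ dyck below
  ... | T , admissible , border-T = M , λ { refl → cong (_, border F) (trans (cong runningBorder columns-M) border-T) }
    where
    open FromColumns admissible
    M-matching = toMatching partner-isMatching
    columns-M : columnsOf M-matching ≡ T
    columns-M = trans (applyUpTo-cong _ _ n same-column) closerColumns-partner
      where
      same-column : ∀ {k} → k < n → #Eprefix (partnerOf M-matching (positionOfS w k)) w ≡ #Eprefix (partner (positionOfS w k)) w
      same-column k<n = cong (λ i → #Eprefix i w)
        (partnerOf-toMatching partner-isMatching
          ([]=⇒<length (proj₁ (positionOfS-spec w (subst (_ <_) (sym (trans (#S-borderTB 0 ts) ts-length)) k<n)))))
    M : MF τ213 F
    M = M-matching , toMatching-perfect partner-isMatching , shape-toMatching partner-isMatching ,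
        λ contains → Admissible.avoids312 admissible (subst Pattern312 columns-M
          (pattern312At⇒pattern312 (pattern213⇒pattern312At
            (isMatching-partnerOf M-matching (toMatching-perfect partner-isMatching)
              (shape-toMatching partner-isMatching))
            (containsM⇒pattern213 M-matching contains))))

  δ-bijection : Bijection (MF-setoid τ213 F) (D2-setoid F)
  δ-bijection = record
    { to        = δ
    ; cong      = cong (λ M → runningBorder (columnsOf M) , border F)
    ; bijective = (λ {M} {M′} → δ-injective {M} {M′}) , δ-surjective }

theorem3p5 : (n : ℕ) (F : Board n) → InFerrersDyck n F →
    (Σ[ wd ∈ ((R : RF τ213 F) → InD2 F (DFR (proj₁ R) , border F)) ]
       Bijective (_≡_ on proj₁) (_≡_ on proj₁)
         (λ (R : RF τ213 F) → D2 F ∋ ((DFR (proj₁ R) , border F) , wd R)))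
    × Bijection (MF-setoid τ213 F) (D2-setoid F)
theorem3p5 n F hF@(ferrers , _) =
  (RookPlacements.δ213-inD2 F ferrers , RookPlacements.δ213-bijective F ferrers) , MatchingBijection.δ-bijection n F hF
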